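{- For any instance of the Freeze-Tag Problem on a weighted star with the awake source robot at the center and an equal number of asleep robots at each leaf, there exists an optimal solution such that the lengths of the edges along any root-to-leaf path in the awakening tree are nondecreasing; that is, along any root-to-leaf path $v_0, r_1, r_2, \dots, r_k$ of the awakening tree, if $r_i$ sleeps at the leaf of spoke $e_i$, then $\ell(e_1)\le \ell(e_2)\le\dots\le \ell(e_k)$.
   Context: Freeze-Tag Problem (FTP): robots are located at vertices of a graph with nonnegative edge weights. One robot, the source $v_0$, is awake at time $0$; all others are asleep. Awake robots move along edges at unit speed. An asleep robot becomes awake when an awake robot reaches its location, and can then move and wake others. The makespan is the time the last robot is awakened; an optimal solution minimizes it. A weighted star has a center joined by spokes $e$ of positive lengths $\ell(e)$ to leaves. A solution is described by an awakening tree: a rooted binary tree spanning all robots, rooted at $v_0$, in which, if robot $r$ is awakened by robot $r'$, the two children of $r$ are the robots awakened next by $r$ and by $r'$ respectively.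
   Formalization: The spoke lengths $\ell(e)$ are positive rationals. -}

module Defs where

open import Data.Nat using (ℕ)
open import Data.Fin using (Fin; _≟_)
open import Data.Product using (_×_; _,_; proj₁)
open import Data.Bool using (if_then_else_)
open import Data.List using (List; []; _∷_; _++_; map; concatMap; allFin)
open import Data.List.Relation.Unary.All using (All)
open import Data.List.Relation.Unary.Linked using (Linked)
open import Data.List.Relation.Binary.Permutation.Propositional using (_↭_)
open import Data.Rational using (ℚ; 0ℚ; _+_; _⊔_; _≤_; _<_)
open import Relation.Nullary using (does)

-- A weighted star with m leaves; spoke i has length ℓ i.
-- Locations of robots: the center or the leaf of spoke i.
data Loc (m : ℕ) : Set where
  center : Loc m
  atLeaf : Fin m → Loc m

dist : {m : ℕ} → (Fin m → ℚ) → Loc m → Loc m → ℚ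
dist ℓ center center = 0ℚ
dist ℓ center (atLeaf j) = ℓ j
dist ℓ (atLeaf i) center = ℓ i
dist ℓ (atLeaf i) (atLeaf j) = if does (i ≟ j) then 0ℚ else ℓ i + ℓ j

-- Asleep robots: p robots at each of the m leaves; robot (i , k) is the
-- k-th robot sleeping at the leaf of spoke i.
Robot : ℕ → ℕ → Set
Robot m p = Fin m × Fin p

spoke : {m p : ℕ} → Robot m p → Fin m
spoke = proj₁

allRobots : (m p : ℕ) → List (Robot m p)
allRobots m p = concatMap (λ i → map (λ k → (i , k)) (allFin p)) (allFin m)

data BTree (A : Set) : Set where
  nil  : BTree A
  node : A → BTree A → BTree A → BTree A

labels : {A : Set} → BTree A → List A
labels nil = []
labels (node a l r) = a ∷ labels l ++ labels r

paths : {A : Set} → BTree A → List (List A)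
paths nil = []
paths (node a nil nil) = (a ∷ []) ∷ []
paths (node a l r) = map (a ∷_) (paths l ++ paths r)

-- An awakening tree: the source v₀ (at the center) is the root and has a
-- single child subtree T; T contains every asleep robot exactly once.
-- In T, the two children of robot r (awakened by r') are the robots
-- awakened next by r and by r' respectively; both robots are at r's
-- location when r wakes.  We represent the awakening tree by T.
IsAwakeningTree : (m p : ℕ) → BTree (Robot m p) → Set
IsAwakeningTree m p T = labels T ↭ allRobots m p

-- Time (relative to the wake-up of the parent, located at `from`) at which
-- the last robot of the subtree is awakened, robots moving along shortest
-- paths at unit speed.
finish : {m p : ℕ} → (Fin m → ℚ) → Loc m → BTree (Robot m p) → ℚ
finish ℓ from nil = 0ℚ
finish ℓ from (node r l t) =
  dist ℓ from (atLeaf (spoke r)) +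
    (finish ℓ (atLeaf (spoke r)) l ⊔ finish ℓ (atLeaf (spoke r)) t)

makespan : {m p : ℕ} → (Fin m → ℚ) → BTree (Robot m p) → ℚ
makespan ℓ T = finish ℓ center T

IsOptimal : (m p : ℕ) → (Fin m → ℚ) → BTree (Robot m p) → Set
IsOptimal m p ℓ T =
  IsAwakeningTree m p T ×
  ((T′ : BTree (Robot m p)) → IsAwakeningTree m p T′ → makespan ℓ T ≤ makespan ℓ T′)

NondecreasingPaths : {m p : ℕ} → (Fin m → ℚ) → BTree (Robot m p) → Set
NondecreasingPaths ℓ T =
  All (Linked (λ r r′ → ℓ (spoke r) ≤ ℓ (spoke r′))) (paths T)

-- Summarize an awakening tree by a spoke tree: processing the wake-ups in
-- order of time, make each spoke, when first reached, a child of the spoke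
-- owning the robot that reached it.  A robot is owned by the spoke where it
-- woke up, and afterwards by every spoke it is the first to reach; so each
-- spoke owns at most p + 1 robots over time and gets at most p + 1 children,
-- and the longest route from the center through the spoke tree takes no
-- longer than the makespan.  Exchanging the root of a subtree with the
-- shortest spoke below it never lengthens these routes, so sorting top-down
-- gives such a spoke tree whose spoke lengths never decrease away from the
-- center.  Chaining the p robots of each spoke, which leaves p + 1 branches
-- free, turns it back into an awakening tree that is no slower and whose
-- paths have nondecreasing spoke lengths.  Applied to an optimal awakening
-- tree (there are finitely many awakening trees) this gives the theorem.

module Submission where

open import Defs
open import Data.Nat as ℕ using (ℕ; zero; suc; z≤n; s≤s)
import Data.Nat.Properties as ℕ
import Algebra.Properties.CommutativeSemigroup ℕ.+-commutativeSemigroup as ℕ+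
open import Data.Nat.ListAction using (sum)
open import Data.Nat.ListAction.Properties using (sum-++; sum-↭)
open import Data.Fin as Fin using (Fin)
open import Data.Product using (Σ; _×_; _,_; proj₁; proj₂)
open import Data.Product.Properties using (≡-dec)
open import Data.Sum using (_⊎_; inj₁; inj₂)
open import Data.Bool using (if_then_else_)
open import Data.Empty using (⊥-elim)
open import Data.Unit using (⊤; tt)
open import Data.Rational using (ℚ; 0ℚ; _+_; _⊔_; _≤_; _<_; _≤?_)
import Data.Rational.Properties as ℚ
open import Data.List as List
  using (List; []; _∷_; _++_; [_]; length; map; concatMap; allFin; filter; cartesianProductWith)
import Data.List.Properties as List
open import Data.List.Membership.Propositional using (_∈_; _∉_; lose)
open import Data.List.Membership.Propositional.Properties
  using ( ∈-++⁺ˡ; ∈-++⁺ʳ; ∈-++⁻; ∈-map⁺; ∈-map⁻; ∈-∃++; ∈-allFin; ∈-concatMap⁺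
        ; ∈-cartesianProductWith⁺; ∈-filter⁺)
open import Data.List.Membership.Propositional.Properties.WithK using (unique∧set⇒bag)
open import Data.List.Relation.Binary.BagAndSetEquality using (∼bag⇒↭)
open import Data.List.Relation.Unary.Any using (here; there; any?)
open import Data.List.Relation.Unary.All as All using (All; []; _∷_)
import Data.List.Relation.Unary.All.Properties as All
open import Data.List.Relation.Unary.AllPairs using ([]; _∷_)
open import Data.List.Relation.Unary.Linked using (Linked; []; [-]; _∷_)
open import Data.List.Relation.Unary.Unique.Propositional using (Unique)
import Data.List.Relation.Unary.Unique.Propositional.Properties as Uniqueₚ
open Uniqueₚ using (Unique[x∷xs]⇒x∉xs)
open import Data.List.Relation.Binary.Permutation.Propositional
  using (_↭_; ↭-refl; ↭-sym; ↭-trans; ↭-prep; ↭-swap; ↭-reflexive; ↭⇒↭ₛ)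
import Data.List.Relation.Binary.Permutation.Propositional as ↭
import Data.List.Relation.Binary.Permutation.Propositional.Properties as ↭
import Data.List.Relation.Binary.Permutation.Setoid.Properties as ↭ₛ
open import Data.Fin.Permutation.Components using (transpose)
open import Data.Rational.Solver using (module +-*-Solver)
import Data.Nat.Solver as ℕₛ
open import Function.Base using (_∘_)
open import Function.Bundles using (mk⇔)
open import Relation.Nullary using (Dec; yes; no; does)
open import Relation.Binary.Bundles using (DecTotalOrder)
open import Relation.Binary.Definitions using (DecidableEquality)
import Data.List.Extrema (DecTotalOrder.totalOrder ℚ.≤-decTotalOrder) as Extrema
open import Relation.Binary.PropositionalEquality
  using (_≡_; _≢_; refl; sym; trans; cong; cong₂; subst; subst₂; setoid; module ≡-Reasoning)

module _ {A : Set} where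

  Unique-++⁻ : ∀ xs {ys : List A} → Unique (xs ++ ys) → Unique xs × Unique ys
  Unique-++⁻ []       u        = [] , u
  Unique-++⁻ (x ∷ xs) (x∉ ∷ u) =
    let uxs , uys = Unique-++⁻ xs u in All.++⁻ˡ xs x∉ ∷ uxs , uys

  ∉-∷⁻ : ∀ {x y} {ys : List A} → x ∉ y ∷ ys → x ≢ y × x ∉ ys
  ∉-∷⁻ x∉ = (λ x≡y → x∉ (here x≡y)) , (λ x∈ → x∉ (there x∈))

  ∉-++⁻ : ∀ {x} xs {ys : List A} → x ∉ xs ++ ys → x ∉ xs × x ∉ ys
  ∉-++⁻ xs x∉ = (λ x∈ → x∉ (∈-++⁺ˡ x∈)) , (λ x∈ → x∉ (∈-++⁺ʳ xs x∈))

  Unique-resp-↭ : {xs ys : List A} → xs ↭ ys → Unique xs → Unique ys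
  Unique-resp-↭ xs↭ys = ↭ₛ.Unique-resp-↭ (setoid A) (↭⇒↭ₛ xs↭ys)

  Unique∧⊆⊇⇒↭ : {xs ys : List A} → Unique xs → Unique ys →
                (∀ {x} → x ∈ xs → x ∈ ys) → (∀ {x} → x ∈ ys → x ∈ xs) → xs ↭ ys
  Unique∧⊆⊇⇒↭ uxs uys xs⊆ys ys⊆xs = ∼bag⇒↭ (unique∧set⇒bag uxs uys (mk⇔ xs⊆ys ys⊆xs))

  _↭?_ : DecidableEquality A → (xs ys : List A) → Dec (xs ↭ ys)
  (_≟_ ↭? []) []       = yes ↭-refl
  (_≟_ ↭? []) (y ∷ ys) = no λ []↭ → ℕ.0≢1+n (↭.↭-length []↭)
  (_≟_ ↭? (x ∷ xs)) ys with any? (x ≟_) ys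
  ... | no x∉ys = no λ x∷xs↭ys → x∉ys (↭.∈-resp-↭ x∷xs↭ys (here refl))
  ... | yes x∈ys with as , bs , refl ← ∈-∃++ x∈ys with (_≟_ ↭? xs) (as ++ bs)
  ...   | yes xs↭ = yes (↭-trans (↭-prep x xs↭) (↭-sym (↭.shift x as bs)))
  ...   | no ¬xs↭ = no λ x∷xs↭ → ¬xs↭ (↭.drop-mid [] as x∷xs↭)

module _ {A B : Set} (f : A → List B) where

  concatMap-↭ : {xs ys : List A} → xs ↭ ys → concatMap f xs ↭ concatMap f ys
  concatMap-↭ ↭.refl            = ↭-refl
  concatMap-↭ (↭.prep x xs↭ys)  = ↭.++⁺ˡ (f x) (concatMap-↭ xs↭ys)
  concatMap-↭ (↭.swap x y xs↭ys) =
    ↭-trans (↭.++⁺ˡ (f x) (↭.++⁺ˡ (f y) (concatMap-↭ xs↭ys))) (↭.shifts (f x) (f y))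
  concatMap-↭ (↭.trans p q)     = ↭-trans (concatMap-↭ p) (concatMap-↭ q)

p≤p+q : ∀ {p q} → 0ℚ ≤ q → p ≤ p + q
p≤p+q {p} {q} 0≤q = ℚ.≤-trans (ℚ.≤-reflexive (sym (ℚ.+-identityʳ p))) (ℚ.+-monoʳ-≤ p 0≤q)

⊔-mono-≤-shifted : ∀ p′ q′ p q {k k′} → p′ + k ≤ p + k′ → q′ + k ≤ q + k′ →
                   (p′ ⊔ q′) + k ≤ (p ⊔ q) + k′
⊔-mono-≤-shifted p′ q′ p q {k} {k′} p′≤p q′≤q with ℚ.⊔-sel p′ q′
... | inj₁ ⊔≡p′ rewrite ⊔≡p′ = ℚ.≤-trans p′≤p (ℚ.+-monoˡ-≤ k′ (ℚ.p≤p⊔q p q))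
... | inj₂ ⊔≡q′ rewrite ⊔≡q′ = ℚ.≤-trans q′≤q (ℚ.+-monoˡ-≤ k′ (ℚ.p≤q⊔p p q))

module _ {A : Set} (f : A → ℕ) where

  sumOf : List A → ℕ
  sumOf xs = sum (map f xs)

  sumOf-++ : ∀ xs ys → sumOf (xs ++ ys) ≡ sumOf xs ℕ.+ sumOf ys
  sumOf-++ xs ys = trans (cong sum (List.map-++ f xs ys)) (sum-++ (map f xs) (map f ys))

  sumOf-↭ : ∀ {xs ys} → xs ↭ ys → sumOf xs ≡ sumOf ys
  sumOf-↭ xs↭ys = sum-↭ (↭.map⁺ f xs↭ys)

module _ {A : Set} (f : A → ℚ) where

  extractMin : ∀ x xs → Σ A λ h → Σ (List A) λ rest →
               (x ∷ xs ↭ h ∷ rest) × All (λ y → f h ≤ f y) rest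
  extractMin x [] = x , [] , ↭-refl , []
  extractMin x (y ∷ ys) with extractMin y ys
  ... | h , rest , y∷ys↭ , h≤rest with f x ≤? f h
  ...   | yes x≤h =
    x , y ∷ ys , ↭-refl , ↭.All-resp-↭ (↭-sym y∷ys↭) (x≤h ∷ All.map (ℚ.≤-trans x≤h) h≤rest)
  ...   | no x≰h  =
    h , x ∷ rest , ↭-trans (↭-prep x y∷ys↭) (↭-swap x h ↭-refl) ,
    ℚ.<⇒≤ (ℚ.≰⇒> x≰h) ∷ h≤rest

-- Binary trees

module _ {A : Set} where

  AtRoot : (A → Set) → BTree A → Set
  AtRoot P nil          = ⊤
  AtRoot P (node a _ _) = P a

module _ {A : Set} (R : A → A → Set) where

  HeapOrdered : BTree A → Set
  HeapOrdered nil          = ⊤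
  HeapOrdered (node a l r) = AtRoot (R a) l × AtRoot (R a) r × HeapOrdered l × HeapOrdered r

  private
    paths-linked-below : ∀ x t → AtRoot (R x) t → HeapOrdered t → All (λ π → Linked R (x ∷ π)) (paths t)

  HeapOrdered⇒paths-linked : ∀ t → HeapOrdered t → All (Linked R) (paths t)
  HeapOrdered⇒paths-linked nil _ = []
  HeapOrdered⇒paths-linked (node a nil nil) _ = [-] ∷ []
  HeapOrdered⇒paths-linked (node a nil r@(node _ _ _)) (_ , a≤r , _ , hr) =
    All.map⁺ (paths-linked-below a r a≤r hr)
  HeapOrdered⇒paths-linked (node a l@(node _ _ _) r) (a≤l , a≤r , hl , hr) =
    All.map⁺ (All.++⁺ (paths-linked-below a l a≤l hl) (paths-linked-below a r a≤r hr))

  paths-linked-below x nil _ _ = []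
  paths-linked-below x (node a nil nil) x≤a _ = (x≤a ∷ [-]) ∷ []
  paths-linked-below x (node a nil r@(node _ _ _)) x≤a (_ , a≤r , _ , hr) =
    All.map⁺ (All.map (x≤a ∷_) (paths-linked-below a r a≤r hr))
  paths-linked-below x (node a l@(node _ _ _) r) x≤a (a≤l , a≤r , hl , hr) =
    All.map⁺ (All.map (x≤a ∷_) (All.++⁺ (paths-linked-below a l a≤l hl) (paths-linked-below a r a≤r hr)))

module _ {A : Set} where

  headOrNil : List (BTree A) → BTree A
  headOrNil []      = nil
  headOrNil (t ∷ _) = t

  All-headOrNil : ∀ {P : BTree A → Set} {ts} → P nil → All P ts → P (headOrNil ts)
  All-headOrNil p-nil []      = p-nil
  All-headOrNil p-nil (p ∷ _) = p

  -- A single waker awakens the robots xs one after another; robot i then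
  -- starts subtree i and the waker itself the last one: |xs| + 1 subtrees.
  comb : List A → List (BTree A) → BTree A
  comb []           ts = nil
  comb (x ∷ [])     ts = node x (headOrNil ts) (headOrNil (List.drop 1 ts))
  comb (x ∷ y ∷ xs) ts = node x (headOrNil ts) (comb (y ∷ xs) (List.drop 1 ts))

  labels-comb : ∀ x xs ts → length ts ℕ.≤ suc (length (x ∷ xs)) →
                labels (comb (x ∷ xs) ts) ↭ (x ∷ xs) ++ concatMap labels ts
  labels-comb x []       []                _ = ↭-refl
  labels-comb x []       (t ∷ [])          _ = ↭-refl
  labels-comb x []       (t ∷ u ∷ [])      _ =
    ↭-reflexive (cong (λ us → x ∷ labels t ++ us) (sym (List.++-identityʳ (labels u))))
  labels-comb x []       (t ∷ u ∷ v ∷ ts) (s≤s (s≤s ()))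
  labels-comb x (y ∷ xs) []               _ = ↭-prep x (labels-comb y xs [] z≤n)
  labels-comb x (y ∷ xs) (t ∷ ts)         (s≤s |ts|≤) =
    ↭-prep x (↭-trans (↭.++⁺ˡ (labels t) (labels-comb y xs ts |ts|≤))
                      (↭.shifts (labels t) (y ∷ xs)))

  spine : List A → BTree A
  spine []       = nil
  spine (x ∷ xs) = node x nil (spine xs)

  labels-spine : ∀ xs → labels (spine xs) ≡ xs
  labels-spine []       = refl
  labels-spine (x ∷ xs) = cong (x ∷_) (labels-spine xs)

  nodesOver : List (BTree A) → A → List (BTree A)
  nodesOver ts a = cartesianProductWith (node a) ts ts

  treesOver : List A → ℕ → List (BTree A)
  treesOver xs zero    = [ nil ]
  treesOver xs (suc n) = nil ∷ concatMap (nodesOver (treesOver xs n)) xs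

  ∈-treesOver : ∀ {xs} n t → length (labels t) ℕ.≤ n → All (_∈ xs) (labels t) → t ∈ treesOver xs n
  ∈-treesOver zero    nil          _         _ = here refl
  ∈-treesOver (suc n) nil          _         _ = here refl
  ∈-treesOver (suc n) (node a l r) (s≤s |t|≤n) (a∈xs ∷ l,r⊆xs) =
    there (∈-concatMap⁺ (nodesOver (treesOver _ n)) (lose a∈xs (∈-cartesianProductWith⁺ (node a)
      (∈-treesOver n l (ℕ.≤-trans (ℕ.m≤m+n _ _) |l|+|r|≤n) (All.++⁻ˡ (labels l) l,r⊆xs))
      (∈-treesOver n r (ℕ.≤-trans (ℕ.m≤n+m _ _) |l|+|r|≤n) (All.++⁻ʳ (labels l) l,r⊆xs)))))
    where
    |l|+|r|≤n : length (labels l) ℕ.+ length (labels r) ℕ.≤ n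
    |l|+|r|≤n = subst (ℕ._≤ n) (List.length-++ (labels l)) |t|≤n

-- Spoke trees

-- visit a β cs: spoke a is first visited at time β, and the spokes of cs
-- are first visited by robots leaving the leaf of a.  The times only
-- matter when a spoke tree is extracted from an awakening tree.
data SpokeTree (m : ℕ) : Set where
  visit : Fin m → ℚ → List (SpokeTree m) → SpokeTree m

module _ {m : ℕ} where

  mutual
    spokes : SpokeTree m → List (Fin m)
    spokes (visit a _ cs) = a ∷ spokesᶠ cs

    spokesᶠ : List (SpokeTree m) → List (Fin m)
    spokesᶠ []       = []
    spokesᶠ (c ∷ cs) = spokes c ++ spokesᶠ cs

  mutual
    size : SpokeTree m → ℕ
    size (visit _ _ cs) = suc (sizeᶠ cs)

    sizeᶠ : List (SpokeTree m) → ℕ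
    sizeᶠ []       = 0
    sizeᶠ (c ∷ cs) = size c ℕ.+ sizeᶠ cs

  mutual
    MaxDegree : ℕ → SpokeTree m → Set
    MaxDegree k (visit _ _ cs) = length cs ℕ.≤ k × MaxDegreeᶠ k cs

    MaxDegreeᶠ : ℕ → List (SpokeTree m) → Set
    MaxDegreeᶠ k []       = ⊤
    MaxDegreeᶠ k (c ∷ cs) = MaxDegree k c × MaxDegreeᶠ k cs

  open import Data.List.Membership.DecPropositional (Fin._≟_ {m}) using (_∈?_)

  δ : Fin m → Fin m → ℕ
  δ i j = if does (i Fin.≟ j) then 1 else 0

  δ-refl : ∀ i → δ i i ≡ 1
  δ-refl i with i Fin.≟ i
  ... | yes _  = refl
  ... | no i≢i = ⊥-elim (i≢i refl)

  δ-distinct : ∀ {i j} → i ≢ j → δ i j ≡ 0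
  δ-distinct {i} {j} i≢j with i Fin.≟ j
  ... | yes i≡j = ⊥-elim (i≢j i≡j)
  ... | no _    = refl

  mutual
    visits : SpokeTree m → List (Fin m × ℚ)
    visits (visit a β cs) = (a , β) ∷ visitsᶠ cs

    visitsᶠ : List (SpokeTree m) → List (Fin m × ℚ)
    visitsᶠ []       = []
    visitsᶠ (c ∷ cs) = visits c ++ visitsᶠ cs

  mutual
    spokes-visits : ∀ S → spokes S ≡ map proj₁ (visits S)
    spokes-visits (visit a β cs) = cong (a ∷_) (spokesᶠ-visitsᶠ cs)

    spokesᶠ-visitsᶠ : ∀ cs → spokesᶠ cs ≡ map proj₁ (visitsᶠ cs)
    spokesᶠ-visitsᶠ []       = refl
    spokesᶠ-visitsᶠ (c ∷ cs) =
      trans (cong₂ _++_ (spokes-visits c) (spokesᶠ-visitsᶠ cs))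
            (sym (List.map-++ proj₁ (visits c) (visitsᶠ cs)))

  mutual
    degree : SpokeTree m → Fin m → ℕ
    degree (visit a _ cs) z = (if does (a Fin.≟ z) then length cs else 0) ℕ.+ degreeᶠ cs z

    degreeᶠ : List (SpokeTree m) → Fin m → ℕ
    degreeᶠ []       z = 0
    degreeᶠ (c ∷ cs) z = degree c z ℕ.+ degreeᶠ cs z

  mutual
    degree-absent : ∀ S z → z ∉ spokes S → degree S z ≡ 0
    degree-absent (visit a β cs) z z∉ with a Fin.≟ z
    ... | yes a≡z = ⊥-elim (z∉ (here (sym a≡z)))
    ... | no _    = degreeᶠ-absent cs z (proj₂ (∉-∷⁻ z∉))

    degreeᶠ-absent : ∀ cs z → z ∉ spokesᶠ cs → degreeᶠ cs z ≡ 0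
    degreeᶠ-absent []       z _  = refl
    degreeᶠ-absent (c ∷ cs) z z∉ =
      let z∉c , z∉cs = ∉-++⁻ (spokes c) z∉ in
      cong₂ ℕ._+_ (degree-absent c z z∉c) (degreeᶠ-absent cs z z∉cs)

  mutual
    MaxDegree-from-degree : ∀ {k} S → (∀ z → degree S z ℕ.≤ k) → MaxDegree k S
    MaxDegree-from-degree (visit a β cs) deg≤k =
      ℕ.≤-trans (length≤degree a) (deg≤k a) ,
      MaxDegreeᶠ-from-degreeᶠ cs (λ z → ℕ.≤-trans (ℕ.m≤n+m (degreeᶠ cs z) _) (deg≤k z))
      where
      length≤degree : ∀ a → length cs ℕ.≤ degree (visit a β cs) a
      length≤degree a with a Fin.≟ a
      ... | yes _  = ℕ.m≤m+n (length cs) (degreeᶠ cs a)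
      ... | no a≢a = ⊥-elim (a≢a refl)

    MaxDegreeᶠ-from-degreeᶠ : ∀ {k} cs → (∀ z → degreeᶠ cs z ℕ.≤ k) → MaxDegreeᶠ k cs
    MaxDegreeᶠ-from-degreeᶠ []       _     = tt
    MaxDegreeᶠ-from-degreeᶠ (c ∷ cs) deg≤k =
      MaxDegree-from-degree c (λ z → ℕ.≤-trans (ℕ.m≤m+n (degree c z) (degreeᶠ cs z)) (deg≤k z)) ,
      MaxDegreeᶠ-from-degreeᶠ cs (λ z → ℕ.≤-trans (ℕ.m≤n+m (degreeᶠ cs z) (degree c z)) (deg≤k z))

  mutual
    graft : Fin m → Fin m → ℚ → SpokeTree m → SpokeTree m
    graft z s β (visit a γ cs) with a Fin.≟ z
    ... | yes _ = visit a γ (visit s β [] ∷ cs)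
    ... | no _  = visit a γ (graftᶠ z s β cs)

    graftᶠ : Fin m → Fin m → ℚ → List (SpokeTree m) → List (SpokeTree m)
    graftᶠ z s β []       = []
    graftᶠ z s β (c ∷ cs) with z ∈? spokes c
    ... | yes _ = graft z s β c ∷ cs
    ... | no _  = c ∷ graftᶠ z s β cs

  mutual
    visits-graft : ∀ z s β S → z ∈ spokes S → visits (graft z s β S) ↭ (s , β) ∷ visits S
    visits-graft z s β (visit a γ cs) z∈ with a Fin.≟ z
    ... | yes _ = ↭-swap (a , γ) (s , β) ↭-refl
    ... | no a≢z with z∈
    ...   | here z≡a   = ⊥-elim (a≢z (sym z≡a))
    ...   | there z∈cs =
      ↭-trans (↭-prep (a , γ) (visitsᶠ-graftᶠ z s β cs z∈cs)) (↭-swap (a , γ) (s , β) ↭-refl)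

    visitsᶠ-graftᶠ : ∀ z s β cs → z ∈ spokesᶠ cs →
                     visitsᶠ (graftᶠ z s β cs) ↭ (s , β) ∷ visitsᶠ cs
    visitsᶠ-graftᶠ z s β (c ∷ cs) z∈ with z ∈? spokes c
    ... | yes z∈c = ↭.++⁺ʳ (visitsᶠ cs) (visits-graft z s β c z∈c)
    ... | no z∉c with ∈-++⁻ (spokes c) z∈
    ...   | inj₁ z∈c  = ⊥-elim (z∉c z∈c)
    ...   | inj₂ z∈cs =
      ↭-trans (↭.++⁺ˡ (visits c) (visitsᶠ-graftᶠ z s β cs z∈cs))
              (↭.shift (s , β) (visits c) (visitsᶠ cs))

  spokes-graft : ∀ z s β S → z ∈ spokes S → spokes (graft z s β S) ↭ s ∷ spokes S
  spokes-graft z s β S z∈ =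
    subst₂ _↭_ (sym (spokes-visits (graft z s β S))) (cong (s ∷_) (sym (spokes-visits S)))
      (↭.map⁺ proj₁ (visits-graft z s β S z∈))

  length-graftᶠ : ∀ z s β cs → length (graftᶠ z s β cs) ≡ length cs
  length-graftᶠ z s β []       = refl
  length-graftᶠ z s β (c ∷ cs) with z ∈? spokes c
  ... | yes _ = refl
  ... | no _  = cong suc (length-graftᶠ z s β cs)

  degree-leaf : ∀ a β z → degree (visit a β []) z ≡ 0
  degree-leaf a β z with a Fin.≟ z
  ... | yes _ = refl
  ... | no _  = refl

  degree-adopt : ∀ a γ s β cs w →
                 degree (visit a γ (visit s β [] ∷ cs)) w ≡ degree (visit a γ cs) w ℕ.+ δ a w
  degree-adopt a γ s β cs w with a Fin.≟ w | s Fin.≟ w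
  ... | yes _ | yes _ = ℕ.+-comm 1 (length cs ℕ.+ degreeᶠ cs w)
  ... | yes _ | no _  = ℕ.+-comm 1 (length cs ℕ.+ degreeᶠ cs w)
  ... | no _  | yes _ = sym (ℕ.+-identityʳ (degreeᶠ cs w))
  ... | no _  | no _  = sym (ℕ.+-identityʳ (degreeᶠ cs w))

  mutual
    degree-graft : ∀ z s β S → z ∈ spokes S → ∀ w →
                   degree (graft z s β S) w ≡ degree S w ℕ.+ δ z w
    degree-graft z s β (visit a γ cs) z∈ w with a Fin.≟ z
    ... | yes refl = degree-adopt a γ s β cs w
    ... | no a≢z with z∈
    ...   | here z≡a   = ⊥-elim (a≢z (sym z≡a))
    ...   | there z∈cs rewrite length-graftᶠ z s β cs =
      trans (cong ((if does (a Fin.≟ w) then length cs else 0) ℕ.+_) (degreeᶠ-graftᶠ z s β cs z∈cs w))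
            (sym (ℕ.+-assoc _ (degreeᶠ cs w) (δ z w)))

    degreeᶠ-graftᶠ : ∀ z s β cs → z ∈ spokesᶠ cs → ∀ w →
                     degreeᶠ (graftᶠ z s β cs) w ≡ degreeᶠ cs w ℕ.+ δ z w
    degreeᶠ-graftᶠ z s β (c ∷ cs) z∈ w with z ∈? spokes c
    ... | yes z∈c =
      trans (cong (ℕ._+ degreeᶠ cs w) (degree-graft z s β c z∈c w))
            (ℕ+.xy∙z≈xz∙y (degree c w) (δ z w) (degreeᶠ cs w))
    ... | no z∉c with ∈-++⁻ (spokes c) z∈
    ...   | inj₁ z∈c  = ⊥-elim (z∉c z∈c)
    ...   | inj₂ z∈cs =
      trans (cong (degree c w ℕ.+_) (degreeᶠ-graftᶠ z s β cs z∈cs w))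
            (sym (ℕ.+-assoc (degree c w) (degreeᶠ cs w) (δ z w)))

module Star {m : ℕ} (ℓ : Fin m → ℚ) (ℓ≥0 : ∀ i → 0ℚ ≤ ℓ i) where

  open import Data.List.Membership.DecPropositional (Fin._≟_ {m}) using (_∈?_)

  leaf-injective : ∀ {i j} → atLeaf {m} i ≡ atLeaf j → i ≡ j
  leaf-injective refl = refl

  depth : Loc m → ℚ
  depth center     = 0ℚ
  depth (atLeaf i) = ℓ i

  dist-self : ∀ i → dist ℓ (atLeaf i) (atLeaf i) ≡ 0ℚ
  dist-self i with i Fin.≟ i
  ... | yes _  = refl
  ... | no i≢i = ⊥-elim (i≢i refl)

  dist-distinct : ∀ x j → x ≢ atLeaf j → dist ℓ x (atLeaf j) ≡ depth x + ℓ j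
  dist-distinct center     j _ = sym (ℚ.+-identityˡ (ℓ j))
  dist-distinct (atLeaf i) j x≢j with i Fin.≟ j
  ... | yes refl = ⊥-elim (x≢j refl)
  ... | no _     = refl

  dist-nonneg : ∀ x y → 0ℚ ≤ dist ℓ x y
  dist-nonneg center     center     = ℚ.≤-refl
  dist-nonneg center     (atLeaf j) = ℓ≥0 j
  dist-nonneg (atLeaf i) center     = ℓ≥0 i
  dist-nonneg (atLeaf i) (atLeaf j) with i Fin.≟ j
  ... | yes _ = ℚ.≤-refl
  ... | no _  = ℚ.+-mono-≤ (ℓ≥0 i) (ℓ≥0 j)

  ℓ≤dist+ℓ : ∀ i j → ℓ i ≤ dist ℓ (atLeaf i) (atLeaf j) + ℓ j
  ℓ≤dist+ℓ i j with i Fin.≟ j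
  ... | yes refl = ℚ.≤-reflexive (sym (ℚ.+-identityˡ (ℓ i)))
  ... | no _     = ℚ.≤-trans (p≤p+q (ℓ≥0 j)) (p≤p+q (ℓ≥0 j))

  finish-nonneg : ∀ {p} x (t : BTree (Robot m p)) → 0ℚ ≤ finish ℓ x t
  finish-nonneg x nil          = ℚ.≤-refl
  finish-nonneg x (node r l t) =
    ℚ.≤-trans (dist-nonneg x (atLeaf (spoke r)))
              (p≤p+q (ℚ.≤-trans (finish-nonneg (atLeaf (spoke r)) l) (ℚ.p≤p⊔q _ _)))

  mutual
    cost : Loc m → SpokeTree m → ℚ
    cost x (visit a _ cs) = dist ℓ x (atLeaf a) + costᶠ a cs

    costᶠ : Fin m → List (SpokeTree m) → ℚ
    costᶠ a []       = 0ℚ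
    costᶠ a (c ∷ cs) = cost (atLeaf a) c ⊔ costᶠ a cs

  mutual
    Scheduled : Loc m → ℚ → SpokeTree m → Set
    Scheduled x τ (visit a β cs) = τ + dist ℓ x (atLeaf a) ≤ β × Scheduledᶠ a β cs

    Scheduledᶠ : Fin m → ℚ → List (SpokeTree m) → Set
    Scheduledᶠ a β []       = ⊤
    Scheduledᶠ a β (c ∷ cs) = Scheduled (atLeaf a) β c × Scheduledᶠ a β cs

  mutual
    Scheduled⇒cost≤ : ∀ x τ S {D} → Scheduled x τ S →
                      (∀ {a β} → (a , β) ∈ visits S → β ≤ D) → τ + cost x S ≤ D
    Scheduled⇒cost≤ x τ (visit a β cs) {D} (τ+d≤β , sch) visits≤D = begin
      τ + (dist ℓ x (atLeaf a) + costᶠ a cs)  ≡⟨ ℚ.+-assoc τ (dist ℓ x (atLeaf a)) (costᶠ a cs) ⟨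
      τ + dist ℓ x (atLeaf a) + costᶠ a cs    ≤⟨ ℚ.+-monoˡ-≤ (costᶠ a cs) τ+d≤β ⟩
      β + costᶠ a cs                          ≤⟨ Scheduledᶠ⇒cost≤ a β cs sch (visits≤D ∘ there)
                                                                   (visits≤D (here refl)) ⟩
      D                                       ∎
      where open ℚ.≤-Reasoning

    Scheduledᶠ⇒cost≤ : ∀ a β cs {D} → Scheduledᶠ a β cs →
                       (∀ {a′ β′} → (a′ , β′) ∈ visitsᶠ cs → β′ ≤ D) → β ≤ D → β + costᶠ a cs ≤ D
    Scheduledᶠ⇒cost≤ a β []       _           _        β≤D =
      ℚ.≤-trans (ℚ.≤-reflexive (ℚ.+-identityʳ β)) β≤D
    Scheduledᶠ⇒cost≤ a β (c ∷ cs) (sc , scs) visits≤D β≤D =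
      ℚ.≤-trans (ℚ.≤-reflexive (ℚ.mono-≤-distrib-⊔ (ℚ.+-monoʳ-≤ β) (cost (atLeaf a) c) _))
        (ℚ.⊔-lub (Scheduled⇒cost≤ (atLeaf a) β c sc (visits≤D ∘ ∈-++⁺ˡ))
                 (Scheduledᶠ⇒cost≤ a β cs scs (visits≤D ∘ ∈-++⁺ʳ (visits c)) β≤D))

  mutual
    Scheduled-graft : ∀ z s β x τ S → Scheduled x τ S →
                      (∀ {γ} → (z , γ) ∈ visits S → γ + dist ℓ (atLeaf z) (atLeaf s) ≤ β) →
                      Scheduled x τ (graft z s β S)
    Scheduled-graft z s β x τ (visit a γ cs) (τ+d≤γ , sch) z-early with a Fin.≟ z
    ... | yes refl = τ+d≤γ , (z-early (here refl) , tt) , sch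
    ... | no _     = τ+d≤γ , Scheduledᶠ-graftᶠ z s β a γ cs sch (z-early ∘ there)

    Scheduledᶠ-graftᶠ : ∀ z s β a γ cs → Scheduledᶠ a γ cs →
                        (∀ {γ′} → (z , γ′) ∈ visitsᶠ cs →
                                  γ′ + dist ℓ (atLeaf z) (atLeaf s) ≤ β) →
                        Scheduledᶠ a γ (graftᶠ z s β cs)
    Scheduledᶠ-graftᶠ z s β a γ []       _          _       = tt
    Scheduledᶠ-graftᶠ z s β a γ (c ∷ cs) (sc , scs) z-early with z ∈? spokes c
    ... | yes _ = Scheduled-graft z s β (atLeaf a) γ c sc (z-early ∘ ∈-++⁺ˡ) , scs
    ... | no _  = sc , Scheduledᶠ-graftᶠ z s β a γ cs scs (z-early ∘ ∈-++⁺ʳ (visits c))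

  mutual
    Monotone : Loc m → SpokeTree m → Set
    Monotone x (visit a _ cs) = depth x ≤ ℓ a × Monotoneᶠ a cs

    Monotoneᶠ : Fin m → List (SpokeTree m) → Set
    Monotoneᶠ a []       = ⊤
    Monotoneᶠ a (c ∷ cs) = Monotone (atLeaf a) c × Monotoneᶠ a cs

  -- Exchanging a and b makes the root edge and the edges to the children
  -- shorter by ℓ a - ℓ b, and the at most two edges at the old position of b
  -- longer by ℓ a - ℓ b.
  module Exchange (a b : Fin m) (a≢b : a ≢ b) (ℓb≤ℓa : ℓ b ≤ ℓ a) where

    swap : Fin m → Fin m
    swap = transpose a b

    swap-a : swap a ≡ b
    swap-a with a Fin.≟ a
    ... | yes _  = refl
    ... | no a≢a = ⊥-elim (a≢a refl)

    swap-b : swap b ≡ a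
    swap-b with b Fin.≟ a
    ... | yes b≡a = ⊥-elim (a≢b (sym b≡a))
    ... | no _ with b Fin.≟ b
    ...   | yes _  = refl
    ...   | no b≢b = ⊥-elim (b≢b refl)

    swap-other : ∀ {i} → i ≢ a → i ≢ b → swap i ≡ i
    swap-other {i} i≢a i≢b with i Fin.≟ a
    ... | yes i≡a = ⊥-elim (i≢a i≡a)
    ... | no _ with i Fin.≟ b
    ...   | yes i≡b = ⊥-elim (i≢b i≡b)
    ...   | no _    = refl

    swap-involutive : ∀ i → swap (swap i) ≡ i
    swap-involutive i with i Fin.≟ a
    ... | yes refl = swap-b
    ... | no i≢a with i Fin.≟ b
    ...   | yes refl = swap-a
    ...   | no i≢b   = swap-other i≢a i≢b

    swap-injective : ∀ {i j} → swap i ≡ swap j → i ≡ j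
    swap-injective {i} {j} eq =
      trans (sym (swap-involutive i)) (trans (cong swap eq) (swap-involutive j))

    mutual
      swapᵗ : SpokeTree m → SpokeTree m
      swapᵗ (visit c γ ds) = visit (swap c) γ (swapᶠ ds)

      swapᶠ : List (SpokeTree m) → List (SpokeTree m)
      swapᶠ []       = []
      swapᶠ (e ∷ ds) = swapᵗ e ∷ swapᶠ ds

    mutual
      spokes-swap : ∀ V → spokes (swapᵗ V) ≡ map swap (spokes V)
      spokes-swap (visit c γ ds) = cong (swap c ∷_) (spokesᶠ-swap ds)

      spokesᶠ-swap : ∀ ds → spokesᶠ (swapᶠ ds) ≡ map swap (spokesᶠ ds)
      spokesᶠ-swap []       = refl
      spokesᶠ-swap (e ∷ ds) =
        trans (cong₂ _++_ (spokes-swap e) (spokesᶠ-swap ds)) (sym (List.map-++ swap (spokes e) (spokesᶠ ds)))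

    mutual
      swap-fresh : ∀ V → a ∉ spokes V → b ∉ spokes V → swapᵗ V ≡ V
      swap-fresh (visit c γ ds) a∉ b∉ =
        let a≢c , a∉ds = ∉-∷⁻ a∉ ; b≢c , b∉ds = ∉-∷⁻ b∉ in
        cong₂ (λ c′ ds′ → visit c′ γ ds′) (swap-other (a≢c ∘ sym) (b≢c ∘ sym))
                                          (swapᶠ-fresh ds a∉ds b∉ds)

      swapᶠ-fresh : ∀ ds → a ∉ spokesᶠ ds → b ∉ spokesᶠ ds → swapᶠ ds ≡ ds
      swapᶠ-fresh []       _  _  = refl
      swapᶠ-fresh (e ∷ ds) a∉ b∉ =
        let a∉e , a∉ds = ∉-++⁻ (spokes e) a∉ ; b∉e , b∉ds = ∉-++⁻ (spokes e) b∉ in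
        cong₂ _∷_ (swap-fresh e a∉e b∉e) (swapᶠ-fresh ds a∉ds b∉ds)

    open +-*-Solver

    mutual
      cost-reroot : ∀ W → a ∉ spokes W → b ∉ spokes W →
                    cost (atLeaf a) W + ℓ b ≤ cost (atLeaf b) W + ℓ a
      cost-reroot (visit c γ ds) a∉ b∉ = ℚ.≤-reflexive (begin
        dist ℓ (atLeaf a) (atLeaf c) + X + ℓ b
          ≡⟨ cong (λ d → d + X + ℓ b) (dist-distinct (atLeaf a) c a≢c) ⟩
        ℓ a + ℓ c + X + ℓ b
          ≡⟨ shuffle (ℓ a) (ℓ b) (ℓ c) X ⟩
        ℓ b + ℓ c + X + ℓ a
          ≡⟨ cong (λ d → d + X + ℓ a) (dist-distinct (atLeaf b) c b≢c) ⟨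
        dist ℓ (atLeaf b) (atLeaf c) + X + ℓ a  ∎)
        where
        open ≡-Reasoning
        X = costᶠ c ds
        a≢c = proj₁ (∉-∷⁻ a∉) ∘ leaf-injective
        b≢c = proj₁ (∉-∷⁻ b∉) ∘ leaf-injective
        shuffle : ∀ x y z X → x + z + X + y ≡ y + z + X + x
        shuffle = solve 4 (λ x y z X → x :+ z :+ X :+ y := y :+ z :+ X :+ x) refl

      costᶠ-reroot : ∀ ds → a ∉ spokesᶠ ds → b ∉ spokesᶠ ds →
                     costᶠ a ds + ℓ b ≤ costᶠ b ds + ℓ a
      costᶠ-reroot []       _  _  = ℚ.+-monoʳ-≤ 0ℚ ℓb≤ℓa
      costᶠ-reroot (e ∷ ds) a∉ b∉ =
        let a∉e , a∉ds = ∉-++⁻ (spokes e) a∉ ; b∉e , b∉ds = ∉-++⁻ (spokes e) b∉ in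
        ⊔-mono-≤-shifted (cost (atLeaf a) e) (costᶠ a ds) (cost (atLeaf b) e) (costᶠ b ds)
          (cost-reroot e a∉e b∉e) (costᶠ-reroot ds a∉ds b∉ds)

    mutual
      cost-swap-inside : ∀ V y → a ∉ spokes V → Unique (spokes V) → y ≢ atLeaf a → y ≢ atLeaf b →
                         cost y (swapᵗ V) + (ℓ b + ℓ b) ≤ cost y V + (ℓ a + ℓ a)
      cost-swap-inside (visit c γ ds) y a∉ u@(_ ∷ uds) y≢a y≢b with c Fin.≟ b
      ... | yes refl
        rewrite swap-b | swapᶠ-fresh ds (proj₂ (∉-∷⁻ a∉)) (Unique[x∷xs]⇒x∉xs u)
              | dist-distinct y a y≢a | dist-distinct y b y≢b = begin
        depth y + ℓ a + costᶠ a ds + (ℓ b + ℓ b)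
          ≡⟨ solve 4 (λ y a b X → y :+ a :+ X :+ (b :+ b) := y :+ a :+ b :+ (X :+ b)) refl
                     (depth y) (ℓ a) (ℓ b) (costᶠ a ds) ⟩
        depth y + ℓ a + ℓ b + (costᶠ a ds + ℓ b)
          ≤⟨ ℚ.+-monoʳ-≤ (depth y + ℓ a + ℓ b) (costᶠ-reroot ds a∉ds b∉ds) ⟩
        depth y + ℓ a + ℓ b + (costᶠ b ds + ℓ a)
          ≡⟨ solve 4 (λ y a b X → y :+ a :+ b :+ (X :+ a) := y :+ b :+ X :+ (a :+ a)) refl
                     (depth y) (ℓ a) (ℓ b) (costᶠ b ds) ⟩
        depth y + ℓ b + costᶠ b ds + (ℓ a + ℓ a)  ∎
        where
        open ℚ.≤-Reasoning
        a∉ds = proj₂ (∉-∷⁻ a∉)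
        b∉ds = Unique[x∷xs]⇒x∉xs u
      ... | no c≢b rewrite swap-other (proj₁ (∉-∷⁻ a∉) ∘ sym) c≢b = begin
        Y + costᶠ c (swapᶠ ds) + (ℓ b + ℓ b)    ≡⟨ ℚ.+-assoc Y _ (ℓ b + ℓ b) ⟩
        Y + (costᶠ c (swapᶠ ds) + (ℓ b + ℓ b))  ≤⟨ ℚ.+-monoʳ-≤ Y (costᶠ-swap-inside ds c a∉ds uds c≢a c≢b) ⟩
        Y + (costᶠ c ds + (ℓ a + ℓ a))          ≡⟨ ℚ.+-assoc Y _ (ℓ a + ℓ a) ⟨
        Y + costᶠ c ds + (ℓ a + ℓ a)            ∎
        where
        open ℚ.≤-Reasoning
        Y = dist ℓ y (atLeaf c)
        c≢a = proj₁ (∉-∷⁻ a∉) ∘ sym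
        a∉ds = proj₂ (∉-∷⁻ a∉)

      costᶠ-swap-inside : ∀ ds c → a ∉ spokesᶠ ds → Unique (spokesᶠ ds) → c ≢ a → c ≢ b →
                          costᶠ c (swapᶠ ds) + (ℓ b + ℓ b) ≤ costᶠ c ds + (ℓ a + ℓ a)
      costᶠ-swap-inside []       c _  _ _   _   = ℚ.+-monoʳ-≤ 0ℚ (ℚ.+-mono-≤ ℓb≤ℓa ℓb≤ℓa)
      costᶠ-swap-inside (e ∷ ds) c a∉ u c≢a c≢b =
        let a∉e , a∉ds = ∉-++⁻ (spokes e) a∉ ; ue , uds = Unique-++⁻ (spokes e) u in
        ⊔-mono-≤-shifted (cost (atLeaf c) (swapᵗ e)) (costᶠ c (swapᶠ ds)) (cost (atLeaf c) e) (costᶠ c ds)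
          (cost-swap-inside e (atLeaf c) a∉e ue (c≢a ∘ leaf-injective) (c≢b ∘ leaf-injective))
          (costᶠ-swap-inside ds c a∉ds uds c≢a c≢b)

    mutual
      cost-swap-below : ∀ V → a ∉ spokes V → Unique (spokes V) →
                        cost (atLeaf b) (swapᵗ V) + ℓ b ≤ cost (atLeaf a) V + ℓ a
      cost-swap-below (visit c γ ds) a∉ u@(_ ∷ uds) with c Fin.≟ b
      ... | yes refl
        rewrite swap-b | swapᶠ-fresh ds (proj₂ (∉-∷⁻ a∉)) (Unique[x∷xs]⇒x∉xs u)
              | dist-distinct (atLeaf b) a (a≢b ∘ sym ∘ leaf-injective)
              | dist-distinct (atLeaf a) b (a≢b ∘ leaf-injective) = begin
        ℓ b + ℓ a + costᶠ a ds + ℓ b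
          ≡⟨ solve 3 (λ a b X → b :+ a :+ X :+ b := a :+ b :+ (X :+ b)) refl (ℓ a) (ℓ b) (costᶠ a ds) ⟩
        ℓ a + ℓ b + (costᶠ a ds + ℓ b)
          ≤⟨ ℚ.+-monoʳ-≤ (ℓ a + ℓ b) (costᶠ-reroot ds (proj₂ (∉-∷⁻ a∉)) (Unique[x∷xs]⇒x∉xs u)) ⟩
        ℓ a + ℓ b + (costᶠ b ds + ℓ a)
          ≡⟨ ℚ.+-assoc (ℓ a + ℓ b) (costᶠ b ds) (ℓ a) ⟨
        ℓ a + ℓ b + costᶠ b ds + ℓ a    ∎
        where open ℚ.≤-Reasoning
      ... | no c≢b
        rewrite swap-other (proj₁ (∉-∷⁻ a∉) ∘ sym) c≢b
              | dist-distinct (atLeaf b) c (c≢b ∘ sym ∘ leaf-injective)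
              | dist-distinct (atLeaf a) c (proj₁ (∉-∷⁻ a∉) ∘ leaf-injective) = begin
        ℓ b + ℓ c + costᶠ c (swapᶠ ds) + ℓ b
          ≡⟨ shuffle (ℓ b) (ℓ c) (costᶠ c (swapᶠ ds)) ⟩
        ℓ c + (costᶠ c (swapᶠ ds) + (ℓ b + ℓ b))
          ≤⟨ ℚ.+-monoʳ-≤ (ℓ c) (costᶠ-swap-inside ds c (proj₂ (∉-∷⁻ a∉)) uds c≢a c≢b) ⟩
        ℓ c + (costᶠ c ds + (ℓ a + ℓ a))
          ≡⟨ shuffle (ℓ a) (ℓ c) (costᶠ c ds) ⟨
        ℓ a + ℓ c + costᶠ c ds + ℓ a              ∎
        where
        open ℚ.≤-Reasoning
        c≢a = proj₁ (∉-∷⁻ a∉) ∘ sym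
        shuffle : ∀ x y X → x + y + X + x ≡ y + (X + (x + x))
        shuffle = solve 3 (λ x y X → x :+ y :+ X :+ x := y :+ (X :+ (x :+ x))) refl

      costᶠ-swap-below : ∀ ds → a ∉ spokesᶠ ds → Unique (spokesᶠ ds) →
                         costᶠ b (swapᶠ ds) + ℓ b ≤ costᶠ a ds + ℓ a
      costᶠ-swap-below []       _  _ = ℚ.+-monoʳ-≤ 0ℚ ℓb≤ℓa
      costᶠ-swap-below (e ∷ ds) a∉ u =
        let a∉e , a∉ds = ∉-++⁻ (spokes e) a∉ ; ue , uds = Unique-++⁻ (spokes e) u in
        ⊔-mono-≤-shifted (cost (atLeaf b) (swapᵗ e)) (costᶠ b (swapᶠ ds)) (cost (atLeaf a) e) (costᶠ a ds)
          (cost-swap-below e a∉e ue) (costᶠ-swap-below ds a∉ds uds)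

    cost-swap-root : ∀ x β cs → Unique (a ∷ spokesᶠ cs) → x ≢ atLeaf a → x ≢ atLeaf b →
                     cost x (visit b β (swapᶠ cs)) ≤ cost x (visit a β cs)
    cost-swap-root x β cs u@(_ ∷ ucs) x≢a x≢b rewrite dist-distinct x b x≢b | dist-distinct x a x≢a = begin
      depth x + ℓ b + costᶠ b (swapᶠ cs)    ≡⟨ ℚ.+-assoc (depth x) (ℓ b) _ ⟩
      depth x + (ℓ b + costᶠ b (swapᶠ cs))  ≡⟨ cong (depth x +_) (ℚ.+-comm (ℓ b) _) ⟩
      depth x + (costᶠ b (swapᶠ cs) + ℓ b)  ≤⟨ ℚ.+-monoʳ-≤ (depth x) (costᶠ-swap-below cs a∉cs ucs) ⟩
      depth x + (costᶠ a cs + ℓ a)          ≡⟨ cong (depth x +_) (ℚ.+-comm (costᶠ a cs) (ℓ a)) ⟩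
      depth x + (ℓ a + costᶠ a cs)          ≡⟨ ℚ.+-assoc (depth x) (ℓ a) _ ⟨
      depth x + ℓ a + costᶠ a cs            ∎
      where
      open ℚ.≤-Reasoning
      a∉cs = Unique[x∷xs]⇒x∉xs u

    mutual
      size-swap : ∀ V → size (swapᵗ V) ≡ size V
      size-swap (visit c γ ds) = cong suc (sizeᶠ-swap ds)

      sizeᶠ-swap : ∀ ds → sizeᶠ (swapᶠ ds) ≡ sizeᶠ ds
      sizeᶠ-swap []       = refl
      sizeᶠ-swap (e ∷ ds) = cong₂ ℕ._+_ (size-swap e) (sizeᶠ-swap ds)

    length-swapᶠ : ∀ ds → length (swapᶠ ds) ≡ length ds
    length-swapᶠ []       = refl
    length-swapᶠ (e ∷ ds) = cong suc (length-swapᶠ ds)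

    mutual
      MaxDegree-swap : ∀ {k} V → MaxDegree k V → MaxDegree k (swapᵗ V)
      MaxDegree-swap {k} (visit c γ ds) (|ds|≤k , ds-ok) =
        subst (ℕ._≤ k) (sym (length-swapᶠ ds)) |ds|≤k , MaxDegreeᶠ-swap ds ds-ok

      MaxDegreeᶠ-swap : ∀ {k} ds → MaxDegreeᶠ k ds → MaxDegreeᶠ k (swapᶠ ds)
      MaxDegreeᶠ-swap []       _             = tt
      MaxDegreeᶠ-swap (e ∷ ds) (e-ok , ds-ok) = MaxDegree-swap e e-ok , MaxDegreeᶠ-swap ds ds-ok

    swap-closed : ∀ {xs y} → a ∈ xs → b ∈ xs → y ∈ xs → swap y ∈ xs
    swap-closed {y = y} a∈ b∈ y∈ with y Fin.≟ a
    ... | yes refl = b∈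
    ... | no _ with y Fin.≟ b
    ...   | yes refl = a∈
    ...   | no _     = y∈

    map-swap-↭ : ∀ {xs} → Unique xs → a ∈ xs → b ∈ xs → map swap xs ↭ xs
    map-swap-↭ {xs} u a∈ b∈ = Unique∧⊆⊇⇒↭ (Uniqueₚ.map⁺ swap-injective u) u image⊆ ⊆image
      where
      image⊆ : ∀ {x} → x ∈ map swap xs → x ∈ xs
      image⊆ x∈ with y , y∈ , refl ← ∈-map⁻ swap x∈ = swap-closed a∈ b∈ y∈
      ⊆image : ∀ {x} → x ∈ xs → x ∈ map swap xs
      ⊆image {x} x∈ = subst (_∈ map swap xs) (swap-involutive x) (∈-map⁺ swap (swap-closed a∈ b∈ x∈))

  Above : Loc m → Fin m → Set
  Above x i = x ≢ atLeaf i × depth x ≤ ℓ i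

  Above-leaf : ∀ {b xs} → b ∉ xs → (∀ {i} → i ∈ xs → ℓ b ≤ ℓ i) →
               ∀ {i} → i ∈ xs → Above (atLeaf b) i
  Above-leaf b∉ b≤ i∈ = (λ b≡i → b∉ (subst (_∈ _) (sym (leaf-injective b≡i)) i∈)) , b≤ i∈

  private
    reroot-at-lightest :
      ∀ x a β cs b → b ∈ a ∷ spokesᶠ cs → (∀ {i} → i ∈ a ∷ spokesᶠ cs → ℓ b ≤ ℓ i) →
      Unique (a ∷ spokesᶠ cs) → (∀ {i} → i ∈ a ∷ spokesᶠ cs → x ≢ atLeaf i) →
      Σ (List (SpokeTree m)) λ cs′ →
        (b ∷ spokesᶠ cs′ ↭ a ∷ spokesᶠ cs) × sizeᶠ cs′ ≡ sizeᶠ cs × length cs′ ≡ length cs ×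
        (∀ {k} → MaxDegreeᶠ k cs → MaxDegreeᶠ k cs′) × cost x (visit b β cs′) ≤ cost x (visit a β cs)
    reroot-at-lightest x a β cs b b∈ b-min u x-out with a Fin.≟ b
    ... | yes refl = cs , ↭-refl , refl , refl , (λ deg → deg) , ℚ.≤-refl
    ... | no a≢b   =
      swapᶠ cs , spokes-↭ , sizeᶠ-swap cs , length-swapᶠ cs , MaxDegreeᶠ-swap cs ,
      cost-swap-root x β cs u (x-out (here refl)) (x-out b∈)
      where
      open Exchange a b a≢b (b-min (here refl))
      spokes-↭ : b ∷ spokesᶠ (swapᶠ cs) ↭ a ∷ spokesᶠ cs
      spokes-↭ = subst (_↭ a ∷ spokesᶠ cs) (cong₂ _∷_ swap-a (sym (spokesᶠ-swap cs)))
                       (map-swap-↭ u (here refl) b∈)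

  lightest : Fin m → List (Fin m) → Fin m
  lightest = Extrema.argmin ℓ

  lightest-∈ : ∀ a xs → lightest a xs ∈ a ∷ xs
  lightest-∈ a xs with Extrema.argmin-sel ℓ a xs
  ... | inj₁ ≡a  = here ≡a
  ... | inj₂ ∈xs = there ∈xs

  lightest-≤ : ∀ a xs {i} → i ∈ a ∷ xs → ℓ (lightest a xs) ≤ ℓ i
  lightest-≤ a xs (here refl) = Extrema.f[argmin]≤f[⊤] {f = ℓ} a xs
  lightest-≤ a xs (there i∈)  = All.lookup (Extrema.f[argmin]≤f[xs] {f = ℓ} a xs) i∈

  -- The recursion is on the children after an exchange, hence the fuel n.
  mutual
    monotonize : ∀ {k} n S → size S ℕ.≤ n → ∀ x → Unique (spokes S) →
                 (∀ {i} → i ∈ spokes S → Above x i) → MaxDegree k S →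
                 Σ (SpokeTree m) λ S′ →
                   (spokes S′ ↭ spokes S) × MaxDegree k S′ × Monotone x S′ × cost x S′ ≤ cost x S
    monotonize (suc n) (visit a β cs) (s≤s size≤n) x u above (|cs|≤k , cs-ok)
      with cs₁ , ↭₁ , size₁ , length₁ , deg₁ , cost₁ ←
             reroot-at-lightest x a β cs _ (lightest-∈ a (spokesᶠ cs)) (lightest-≤ a (spokesᶠ cs))
                                u (proj₁ ∘ above)
      with u₁@(_ ∷ ucs₁) ← Unique-resp-↭ (↭-sym ↭₁) u
      with cs₂ , ↭₂ , deg₂ , length₂ , mono₂ , cost₂ ←
             monotonizeᶠ n cs₁ (subst (ℕ._≤ n) (sym size₁) size≤n) (lightest a (spokesᶠ cs)) ucs₁
               (Above-leaf (Unique[x∷xs]⇒x∉xs u₁) (lightest-≤ a (spokesᶠ cs) ∘ ↭.∈-resp-↭ ↭₁ ∘ there))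
               (deg₁ cs-ok) =
      visit b β cs₂ , ↭-trans (↭-prep b ↭₂) ↭₁ ,
      (subst (ℕ._≤ _) (sym (trans length₂ length₁)) |cs|≤k , deg₂) ,
      (proj₂ (above (↭.∈-resp-↭ ↭₁ (here refl))) , mono₂) ,
      ℚ.≤-trans (ℚ.+-monoʳ-≤ (dist ℓ x (atLeaf b)) cost₂) cost₁
      where b = lightest a (spokesᶠ cs)

    monotonizeᶠ : ∀ {k} n cs → sizeᶠ cs ℕ.≤ n → ∀ b → Unique (spokesᶠ cs) →
                  (∀ {i} → i ∈ spokesᶠ cs → Above (atLeaf b) i) → MaxDegreeᶠ k cs →
                  Σ (List (SpokeTree m)) λ cs′ → (spokesᶠ cs′ ↭ spokesᶠ cs) × MaxDegreeᶠ k cs′ ×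
                    length cs′ ≡ length cs × Monotoneᶠ b cs′ × costᶠ b cs′ ≤ costᶠ b cs
    monotonizeᶠ n []       _      b _ _     _              = [] , ↭-refl , tt , refl , tt , ℚ.≤-refl
    monotonizeᶠ n (c ∷ cs) size≤n b u above (c-ok , cs-ok)
      with uc , ucs ← Unique-++⁻ (spokes c) u
      with c′ , ↭c , deg-c , mono-c , cost-c ←
             monotonize n c (ℕ.≤-trans (ℕ.m≤m+n (size c) (sizeᶠ cs)) size≤n) (atLeaf b) uc
                        (above ∘ ∈-++⁺ˡ) c-ok
         | cs′ , ↭cs , deg-cs , length-cs , mono-cs , cost-cs ←
             monotonizeᶠ n cs (ℕ.≤-trans (ℕ.m≤n+m (sizeᶠ cs) (size c)) size≤n) b ucs
                         (above ∘ ∈-++⁺ʳ (spokes c)) cs-ok =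
      c′ ∷ cs′ , ↭.++⁺ ↭c ↭cs , (deg-c , deg-cs) , cong suc length-cs , (mono-c , mono-cs) ,
      ℚ.⊔-mono-≤ cost-c cost-cs

  module Realization (q : ℕ) where

    p : ℕ
    p = suc q

    finishᶠ : Loc m → List (BTree (Robot m p)) → ℚ
    finishᶠ y []       = 0ℚ
    finishᶠ y (t ∷ ts) = finish ℓ y t ⊔ finishᶠ y ts

    Descends : Robot m p → Robot m p → Set
    Descends r r′ = ℓ (spoke r) ≤ ℓ (spoke r′)

    robotsAt : Fin m → List (Robot m p)
    robotsAt a = map (λ k → (a , k)) (allFin p)

    mutual
      realize : SpokeTree m → BTree (Robot m p)
      realize (visit a _ cs) = comb (robotsAt a) (realizeᶠ cs)

      realizeᶠ : List (SpokeTree m) → List (BTree (Robot m p))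
      realizeᶠ []       = []
      realizeᶠ (c ∷ cs) = realize c ∷ realizeᶠ cs

    private
      finish-first-two : ∀ y ts →
                         finish ℓ y (headOrNil ts) ⊔ finish ℓ y (headOrNil (List.drop 1 ts)) ≤ finishᶠ y ts
      finish-first-two y []           = ℚ.≤-reflexive (ℚ.⊔-idem 0ℚ)
      finish-first-two y (t ∷ [])     = ℚ.≤-refl
      finish-first-two y (t ∷ u ∷ ts) =
        ℚ.⊔-monoʳ-≤ (finish ℓ y t) (ℚ.p≤p⊔q (finish ℓ y u) (finishᶠ y ts))

      finish-first-rest : ∀ y ts → finish ℓ y (headOrNil ts) ⊔ finishᶠ y (List.drop 1 ts) ≤ finishᶠ y ts
      finish-first-rest y []       = ℚ.≤-reflexive (ℚ.⊔-idem 0ℚ)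
      finish-first-rest y (t ∷ ts) = ℚ.≤-refl

    finish-comb : ∀ x a k ks ts →
                  finish ℓ x (comb (map (λ k → (a , k)) (k ∷ ks)) ts) ≤
                  dist ℓ x (atLeaf a) + finishᶠ (atLeaf a) ts
    finish-comb x a k []        ts = ℚ.+-monoʳ-≤ (dist ℓ x (atLeaf a)) (finish-first-two (atLeaf a) ts)
    finish-comb x a k (k′ ∷ ks) ts = ℚ.+-monoʳ-≤ (dist ℓ x (atLeaf a)) (ℚ.≤-trans
      (ℚ.⊔-monoʳ-≤ (finish ℓ (atLeaf a) (headOrNil ts)) (begin
        finish ℓ (atLeaf a) (comb (map (λ k → (a , k)) (k′ ∷ ks)) (List.drop 1 ts))
          ≤⟨ finish-comb (atLeaf a) a k′ ks (List.drop 1 ts) ⟩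
        dist ℓ (atLeaf a) (atLeaf a) + finishᶠ (atLeaf a) (List.drop 1 ts)
          ≡⟨ cong (_+ finishᶠ (atLeaf a) (List.drop 1 ts)) (dist-self a) ⟩
        0ℚ + finishᶠ (atLeaf a) (List.drop 1 ts)
          ≡⟨ ℚ.+-identityˡ _ ⟩
        finishᶠ (atLeaf a) (List.drop 1 ts) ∎))
      (finish-first-rest (atLeaf a) ts))
      where open ℚ.≤-Reasoning

    mutual
      finish-realize : ∀ x S → finish ℓ x (realize S) ≤ cost x S
      finish-realize x (visit a _ cs) =
        ℚ.≤-trans (finish-comb x a Fin.zero (List.tabulate Fin.suc) (realizeᶠ cs))
                  (ℚ.+-monoʳ-≤ (dist ℓ x (atLeaf a)) (finishᶠ-realizeᶠ a cs))

      finishᶠ-realizeᶠ : ∀ a cs → finishᶠ (atLeaf a) (realizeᶠ cs) ≤ costᶠ a cs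
      finishᶠ-realizeᶠ a []       = ℚ.≤-refl
      finishᶠ-realizeᶠ a (c ∷ cs) = ℚ.⊔-mono-≤ (finish-realize (atLeaf a) c) (finishᶠ-realizeᶠ a cs)

    length-robotsAt : ∀ a → length (robotsAt a) ≡ p
    length-robotsAt a = trans (List.length-map (λ k → (a , k)) (allFin p)) (List.length-tabulate (λ k → k))

    length-realizeᶠ : ∀ cs → length (realizeᶠ cs) ≡ length cs
    length-realizeᶠ []       = refl
    length-realizeᶠ (c ∷ cs) = cong suc (length-realizeᶠ cs)

    mutual
      labels-realize : ∀ S → MaxDegree (suc p) S → labels (realize S) ↭ concatMap robotsAt (spokes S)
      labels-realize (visit a _ cs) (|cs|≤ , cs-ok) =
        ↭-trans (labels-comb (a , Fin.zero) (map (λ k → (a , k)) (List.tabulate Fin.suc)) (realizeᶠ cs) |ts|≤)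
                (↭.++⁺ˡ (robotsAt a) (labelsᶠ-realizeᶠ cs cs-ok))
        where
        |ts|≤ : length (realizeᶠ cs) ℕ.≤ suc (length (robotsAt a))
        |ts|≤ = subst₂ ℕ._≤_ (sym (length-realizeᶠ cs)) (cong suc (sym (length-robotsAt a))) |cs|≤

      labelsᶠ-realizeᶠ : ∀ cs → MaxDegreeᶠ (suc p) cs →
                         concatMap labels (realizeᶠ cs) ↭ concatMap robotsAt (spokesᶠ cs)
      labelsᶠ-realizeᶠ []       _              = ↭-refl
      labelsᶠ-realizeᶠ (c ∷ cs) (c-ok , cs-ok) =
        ↭-trans (↭.++⁺ (labels-realize c c-ok) (labelsᶠ-realizeᶠ cs cs-ok))
                (↭-reflexive (sym (List.concatMap-++ robotsAt (spokes c) (spokesᶠ cs))))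

    Hangs : Fin m → BTree (Robot m p) → Set
    Hangs a t = HeapOrdered Descends t × AtRoot (λ r → ℓ a ≤ ℓ (spoke r)) t

    AtRoot-comb : ∀ {x} a (k : Fin p) ks ts → ℓ x ≤ ℓ a →
                  AtRoot (λ r → ℓ x ≤ ℓ (spoke r)) (comb (map (λ k → (a , k)) (k ∷ ks)) ts)
    AtRoot-comb a k []       ts pk = pk
    AtRoot-comb a k (_ ∷ ks) ts pk = pk

    HeapOrdered-comb : ∀ a (k : Fin p) ks ts → All (Hangs a) ts →
                       HeapOrdered Descends (comb (map (λ k → (a , k)) (k ∷ ks)) ts)
    HeapOrdered-comb a k [] ts hangs =
      proj₂ first , proj₂ second , proj₁ first , proj₁ second
      where
      first : Hangs a (headOrNil ts)
      first = All-headOrNil (tt , tt) hangs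
      second : Hangs a (headOrNil (List.drop 1 ts))
      second = All-headOrNil (tt , tt) (All.drop⁺ 1 hangs)
    HeapOrdered-comb a k (k′ ∷ ks) ts hangs =
      proj₂ first , AtRoot-comb a k′ ks (List.drop 1 ts) ℚ.≤-refl ,
      proj₁ first , HeapOrdered-comb a k′ ks (List.drop 1 ts) (All.drop⁺ 1 hangs)
      where
      first : Hangs a (headOrNil ts)
      first = All-headOrNil (tt , tt) hangs

    mutual
      HeapOrdered-realize : ∀ x S → Monotone x S → HeapOrdered Descends (realize S)
      HeapOrdered-realize x (visit a β cs) (_ , mono) =
        HeapOrdered-comb a Fin.zero (List.tabulate Fin.suc) (realizeᶠ cs) (realizeᶠ-hangs a cs mono)

      realizeᶠ-hangs : ∀ a cs → Monotoneᶠ a cs → All (Hangs a) (realizeᶠ cs)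
      realizeᶠ-hangs a []                  _                          = []
      realizeᶠ-hangs a (visit c γ ds ∷ cs) ((ℓa≤ℓc , mono-ds) , mono-cs) =
        (HeapOrdered-realize (atLeaf a) (visit c γ ds) (ℓa≤ℓc , mono-ds) ,
         AtRoot-comb c Fin.zero (List.tabulate Fin.suc) (realizeᶠ ds) ℓa≤ℓc) ∷ realizeᶠ-hangs a cs mono-cs

  module Simulation (q : ℕ) where

    open Realization q using (p; robotsAt)

    Tree : Set
    Tree = BTree (Robot m p)

    count : Fin m → List (Robot m p) → ℕ
    count z = sumOf (λ r → δ (spoke r) z)

    count-robotsAt-distinct : ∀ {i z} → i ≢ z → count z (robotsAt i) ≡ 0
    count-robotsAt-distinct {i} {z} i≢z = go (allFin p)
      where
      go : ∀ ks → count z (map (λ k → (i , k)) ks) ≡ 0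
      go []       = refl
      go (k ∷ ks) = cong₂ ℕ._+_ (δ-distinct i≢z) (go ks)

    count-robotsAt-same : ∀ z → count z (robotsAt z) ≡ p
    count-robotsAt-same z = trans (go (allFin p)) (List.length-tabulate (λ k → k))
      where
      go : ∀ ks → count z (map (λ k → (z , k)) ks) ≡ length ks
      go []       = refl
      go (k ∷ ks) = cong₂ ℕ._+_ (δ-refl z) (go ks)

    count-concatMap-robotsAt : ∀ z xs → Unique xs → z ∈ xs → count z (concatMap robotsAt xs) ≡ p
    count-concatMap-robotsAt z (x ∷ xs) u@(_ ∷ uxs) z∈ =
      trans (sumOf-++ _ (robotsAt x) (concatMap robotsAt xs)) (go z∈)
      where
      absent : ∀ ys → z ∉ ys → count z (concatMap robotsAt ys) ≡ 0
      absent []       _  = refl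
      absent (y ∷ ys) z∉ =
        trans (sumOf-++ _ (robotsAt y) (concatMap robotsAt ys))
              (cong₂ ℕ._+_ (count-robotsAt-distinct (proj₁ (∉-∷⁻ z∉) ∘ sym))
                           (absent ys (proj₂ (∉-∷⁻ z∉))))
      go : z ∈ x ∷ xs → count z (robotsAt x) ℕ.+ count z (concatMap robotsAt xs) ≡ p
      go (here refl) = trans (cong₂ ℕ._+_ (count-robotsAt-same z) (absent xs (Unique[x∷xs]⇒x∉xs u)))
                             (ℕ.+-identityʳ p)
      go (there z∈xs) =
        trans (cong (ℕ._+ count z (concatMap robotsAt xs)) (count-robotsAt-distinct x≢z))
              (count-concatMap-robotsAt z xs uxs z∈xs)
        where
        x≢z : x ≢ z
        x≢z x≡z = Unique[x∷xs]⇒x∉xs u (subst (_∈ xs) (sym x≡z) z∈xs)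

    count-allRobots : ∀ z → count z (allRobots m p) ≡ p
    count-allRobots z = count-concatMap-robotsAt z (allFin m) (Uniqueₚ.allFin⁺ m) (∈-allFin z)

    -- An agent is a branch of the awakening tree still to be performed: a
    -- robot standing at the leaf of spoke `at` from time `since` that next
    -- wakes `target`, after which `left` and `right` start from there.  Its
    -- owner is the spoke that will count as its parent in the spoke tree.
    record Agent : Set where
      constructor agent
      field
        owner  : Fin m
        at     : Fin m
        since  : ℚ
        target : Robot m p
        left   : Tree
        right  : Tree

      arrival : ℚ
      arrival = since + dist ℓ (atLeaf at) (atLeaf (spoke target))

      pending : List (Robot m p)
      pending = labels (node target left right)

    open Agent

    owned : List Agent → Fin m → ℕ
    owned W z = sumOf (λ g → δ (owner g) z) W

    asleep : List Agent → Fin m → ℕ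
    asleep W z = sumOf (λ g → count z (pending g)) W

    workload : List Agent → ℕ
    workload = sumOf (λ g → length (pending g))

    spawn : Fin m → Fin m → ℚ → Tree → List Agent
    spawn o s τ nil          = []
    spawn o s τ (node r l t) = [ agent o s τ r l t ]

    owned-spawn : ∀ o s τ t w → owned (spawn o s τ t) w ℕ.≤ δ o w
    owned-spawn o s τ nil          w = z≤n
    owned-spawn o s τ (node r l t) w = ℕ.≤-reflexive (ℕ.+-identityʳ (δ o w))

    asleep-spawn : ∀ o s τ t w → asleep (spawn o s τ t) w ≡ count w (labels t)
    asleep-spawn o s τ nil          w = refl
    asleep-spawn o s τ (node r l t) w = ℕ.+-identityʳ _

    workload-spawn : ∀ o s τ t → workload (spawn o s τ t) ≡ length (labels t)
    workload-spawn o s τ nil          = refl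
    workload-spawn o s τ (node r l t) = ℕ.+-identityʳ _

    -- departs: had the agent left the leaf of its owner at the owner's first
    -- visit, it could have passed the center already; so a spoke it reaches
    -- first can be made a child of its owner.
    record Valid (S : SpokeTree m) (θ D : ℚ) (g : Agent) : Set where
      field
        owner∈   : owner g ∈ spokes S
        at∈      : at g ∈ spokes S
        departs  : ∀ {γ} → (owner g , γ) ∈ visits S → γ + ℓ (owner g) ≤ since g + ℓ (at g)
        arrives  : θ ≤ arrival g
        finishes : since g + finish ℓ (atLeaf (at g)) (node (target g) (left g) (right g)) ≤ D

    -- S is the spoke tree of the spokes visited so far, W the pending
    -- agents, θ the current time and D the makespan to be bounded.  Each
    -- child of z, agent owned by z and robot of z still asleep accounts for
    -- one of the p + 1 robots z ever owns.
    record Invariant (S : SpokeTree m) (W : List Agent) (θ D : ℚ) : Set where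
      field
        unique    : Unique (spokes S)
        scheduled : Scheduled center 0ℚ S
        visited   : ∀ {a β} → (a , β) ∈ visits S → β ≤ θ
        θ≤D       : θ ≤ D
        valid     : All (Valid S θ D) W
        capacity  : ∀ z → z ∈ spokes S → degree S z ℕ.+ owned W z ℕ.+ asleep W z ℕ.≤ suc p
        untouched : ∀ z → z ∉ spokes S → asleep W z ≡ p

    Invariant-resp-↭ : ∀ {S W W′ θ D} → W ↭ W′ → Invariant S W θ D → Invariant S W′ θ D
    Invariant-resp-↭ {S} W↭W′ inv = record
      { unique    = unique
      ; scheduled = scheduled
      ; visited   = visited
      ; θ≤D       = θ≤D
      ; valid     = ↭.All-resp-↭ W↭W′ valid
      ; capacity  = λ z z∈ → subst (ℕ._≤ suc p)
                      (cong₂ (λ o a → degree S z ℕ.+ o ℕ.+ a) (sumOf-↭ _ W↭W′) (sumOf-↭ _ W↭W′))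
                      (capacity z z∈)
      ; untouched = λ z z∉ → trans (sym (sumOf-↭ _ W↭W′)) (untouched z z∉)
      }
      where open Invariant inv

    spawn-valid : ∀ {S θ D} o s τ u → o ∈ spokes S → s ∈ spokes S →
                  (∀ {γ} → (o , γ) ∈ visits S → γ + ℓ o ≤ τ + ℓ s) → θ ≤ τ →
                  τ + finish ℓ (atLeaf s) u ≤ D → All (Valid S θ D) (spawn o s τ u)
    spawn-valid o s τ nil            _  _  _       _   _   = []
    spawn-valid o s τ (node r l t) o∈ s∈ departs θ≤τ fin = record
      { owner∈ = o∈ ; at∈ = s∈ ; departs = departs
      ; arrives = ℚ.≤-trans θ≤τ (p≤p+q (dist-nonneg (atLeaf s) (atLeaf (spoke r)))) ; finishes = fin } ∷ []

    module Step {S z y τ r l t rest θ D}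
                (inv : Invariant S (agent z y τ r l t ∷ rest) θ D)
                (earliest : All (λ g → arrival (agent z y τ r l t) ≤ arrival g) rest) where

      open Invariant inv
      open ℕₛ.+-*-Solver

      h : Agent
      h = agent z y τ r l t

      h-valid : Valid S θ D h
      h-valid = All.head valid

      s : Fin m
      s = spoke r

      τ′ : ℚ
      τ′ = arrival h

      -- Robot r is awakened at time τ′; the branch l is performed by r and
      -- the branch t by its waker, which is owned by o afterwards.
      next : Fin m → List Agent
      next o = spawn s s τ′ l ++ spawn o s τ′ t ++ rest

      sumOf-next : ∀ (f : Agent → ℕ) o →
                   sumOf f (next o) ≡
                   sumOf f (spawn s s τ′ l) ℕ.+ (sumOf f (spawn o s τ′ t) ℕ.+ sumOf f rest)
      sumOf-next f o = trans (sumOf-++ f (spawn s s τ′ l) _)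
                             (cong (sumOf f (spawn s s τ′ l) ℕ.+_) (sumOf-++ f (spawn o s τ′ t) rest))

      asleep-next : ∀ o w → asleep (h ∷ rest) w ≡ δ s w ℕ.+ asleep (next o) w
      asleep-next o w = begin
        δ s w ℕ.+ count w (labels l ++ labels t) ℕ.+ asleep rest w
          ≡⟨ cong (λ c → δ s w ℕ.+ c ℕ.+ asleep rest w) (sumOf-++ _ (labels l) (labels t)) ⟩
        δ s w ℕ.+ (count w (labels l) ℕ.+ count w (labels t)) ℕ.+ asleep rest w
          ≡⟨ solve 4 (λ d x y a → d :+ (x :+ y) :+ a := d :+ (x :+ (y :+ a))) refl
                     (δ s w) (count w (labels l)) (count w (labels t)) (asleep rest w) ⟩
        δ s w ℕ.+ (count w (labels l) ℕ.+ (count w (labels t) ℕ.+ asleep rest w))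
          ≡⟨ cong (δ s w ℕ.+_) (cong₂ (λ x y → x ℕ.+ (y ℕ.+ asleep rest w))
                                      (asleep-spawn s s τ′ l w) (asleep-spawn o s τ′ t w)) ⟨
        δ s w ℕ.+ (asleep (spawn s s τ′ l) w ℕ.+ (asleep (spawn o s τ′ t) w ℕ.+ asleep rest w))
          ≡⟨ cong (δ s w ℕ.+_) (sumOf-next _ o) ⟨
        δ s w ℕ.+ asleep (next o) w ∎
        where open ≡-Reasoning

      owned-next : ∀ o w → owned (next o) w ℕ.≤ δ s w ℕ.+ (δ o w ℕ.+ owned rest w)
      owned-next o w = subst (ℕ._≤ _) (sym (sumOf-next _ o))
        (ℕ.+-mono-≤ (owned-spawn s s τ′ l w) (ℕ.+-monoˡ-≤ (owned rest w) (owned-spawn o s τ′ t w)))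

      workload-next : ∀ o → suc (workload (next o)) ≡ workload (h ∷ rest)
      workload-next o = cong suc (begin
        workload (next o)
          ≡⟨ sumOf-next _ o ⟩
        workload (spawn s s τ′ l) ℕ.+ (workload (spawn o s τ′ t) ℕ.+ workload rest)
          ≡⟨ cong₂ (λ x y → x ℕ.+ (y ℕ.+ workload rest))
                   (workload-spawn s s τ′ l) (workload-spawn o s τ′ t) ⟩
        length (labels l) ℕ.+ (length (labels t) ℕ.+ workload rest)
          ≡⟨ ℕ.+-assoc (length (labels l)) _ _ ⟨
        length (labels l) ℕ.+ length (labels t) ℕ.+ workload rest
          ≡⟨ cong (ℕ._+ workload rest) (List.length-++ (labels l)) ⟨
        length (labels l ++ labels t) ℕ.+ workload rest ∎)
        where open ≡-Reasoning

      θ≤τ′ : θ ≤ τ′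
      θ≤τ′ = Valid.arrives h-valid

      finishes-below : ∀ X → X ≤ finish ℓ (atLeaf s) l ⊔ finish ℓ (atLeaf s) t → τ′ + X ≤ D
      finishes-below X X≤ = begin
        τ + dist ℓ (atLeaf y) (atLeaf s) + X
          ≡⟨ ℚ.+-assoc τ (dist ℓ (atLeaf y) (atLeaf s)) X ⟩
        τ + (dist ℓ (atLeaf y) (atLeaf s) + X)
          ≤⟨ ℚ.+-monoʳ-≤ τ (ℚ.+-monoʳ-≤ (dist ℓ (atLeaf y) (atLeaf s)) X≤) ⟩
        τ + finish ℓ (atLeaf y) (node r l t)
          ≤⟨ Valid.finishes h-valid ⟩
        D ∎
        where open ℚ.≤-Reasoning

      l-finishes : τ′ + finish ℓ (atLeaf s) l ≤ D
      l-finishes = finishes-below _ (ℚ.p≤p⊔q (finish ℓ (atLeaf s) l) (finish ℓ (atLeaf s) t))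

      t-finishes : τ′ + finish ℓ (atLeaf s) t ≤ D
      t-finishes = finishes-below _ (ℚ.p≤q⊔p (finish ℓ (atLeaf s) l) (finish ℓ (atLeaf s) t))

      τ′≤D : τ′ ≤ D
      τ′≤D = ℚ.≤-trans (p≤p+q (finish-nonneg (atLeaf s) l)) l-finishes

      rest-valid : ∀ {S′} → (∀ {w} → w ∈ spokes S → w ∈ spokes S′) →
                   (∀ {o γ} → o ∈ spokes S → (o , γ) ∈ visits S′ → (o , γ) ∈ visits S) →
                   All (Valid S′ τ′ D) rest
      rest-valid {S′} grow old = All.zipWith revalidate (All.tail valid , earliest)
        where
        revalidate : ∀ {g} → Valid S θ D g × τ′ ≤ arrival g → Valid S′ τ′ D g
        revalidate (v , τ′≤) = record
          { owner∈ = grow owner∈ ; at∈ = grow at∈ ; departs = departs ∘ old owner∈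
          ; arrives = τ′≤ ; finishes = finishes }
          where open Valid v

      owned-rest-absent : ∀ w → w ∉ spokes S → owned rest w ≡ 0
      owned-rest-absent w w∉ = go (All.tail valid)
        where
        go : ∀ {gs} → All (Valid S θ D) gs → owned gs w ≡ 0
        go []       = refl
        go (v ∷ vs) = cong₂ ℕ._+_ (δ-distinct λ o≡w → w∉ (subst (_∈ spokes S) o≡w (Valid.owner∈ v)))
                                  (go vs)

      asleep-next-elsewhere : ∀ o {w} → s ≢ w → asleep (next o) w ≡ asleep (h ∷ rest) w
      asleep-next-elsewhere o {w} s≢w =
        sym (trans (asleep-next o w) (cong (ℕ._+ asleep (next o) w) (δ-distinct s≢w)))

      z∈ : z ∈ spokes S
      z∈ = Valid.owner∈ h-valid

      z-departs : ∀ {γ} → (z , γ) ∈ visits S → γ + ℓ z ≤ τ′ + ℓ s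
      z-departs {γ} v∈ = begin
        γ + ℓ z                                   ≤⟨ Valid.departs h-valid v∈ ⟩
        τ + ℓ y                                   ≤⟨ ℚ.+-monoʳ-≤ τ (ℓ≤dist+ℓ y s) ⟩
        τ + (dist ℓ (atLeaf y) (atLeaf s) + ℓ s)  ≡⟨ ℚ.+-assoc τ _ (ℓ s) ⟨
        τ′ + ℓ s                                  ∎
        where open ℚ.≤-Reasoning

      revisit : s ∈ spokes S → Invariant S (next z) τ′ D
      revisit s∈ = record
        { unique    = unique
        ; scheduled = scheduled
        ; visited   = visited′
        ; θ≤D       = τ′≤D
        ; valid     = All.++⁺ (spawn-valid s s τ′ l s∈ s∈ s-departs ℚ.≤-refl l-finishes)
                     (All.++⁺ (spawn-valid z s τ′ t z∈ s∈ z-departs ℚ.≤-refl t-finishes)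
                              (rest-valid (λ w∈ → w∈) (λ _ v∈ → v∈)))
        ; capacity  = λ w w∈ → ℕ.≤-trans (capacity-kept w) (capacity w w∈)
        ; untouched = λ w w∉ →
            trans (asleep-next-elsewhere z (λ s≡w → w∉ (subst (_∈ spokes S) s≡w s∈))) (untouched w w∉)
        }
        where
        visited′ : ∀ {a β} → (a , β) ∈ visits S → β ≤ τ′
        visited′ v∈ = ℚ.≤-trans (visited v∈) θ≤τ′

        s-departs : ∀ {γ} → (s , γ) ∈ visits S → γ + ℓ s ≤ τ′ + ℓ s
        s-departs = ℚ.+-monoˡ-≤ (ℓ s) ∘ visited′

        capacity-kept : ∀ w → degree S w ℕ.+ owned (next z) w ℕ.+ asleep (next z) w ℕ.≤
                              degree S w ℕ.+ owned (h ∷ rest) w ℕ.+ asleep (h ∷ rest) w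
        capacity-kept w = begin
          degree S w ℕ.+ owned (next z) w ℕ.+ asleep (next z) w
            ≤⟨ ℕ.+-monoˡ-≤ (asleep (next z) w) (ℕ.+-monoʳ-≤ (degree S w) (owned-next z w)) ⟩
          degree S w ℕ.+ (δ s w ℕ.+ (δ z w ℕ.+ owned rest w)) ℕ.+ asleep (next z) w
            ≡⟨ solve 5 (λ d i j o a → d :+ (i :+ (j :+ o)) :+ a := d :+ (j :+ o) :+ (i :+ a)) refl
                 (degree S w) (δ s w) (δ z w) (owned rest w) (asleep (next z) w) ⟩
          degree S w ℕ.+ owned (h ∷ rest) w ℕ.+ (δ s w ℕ.+ asleep (next z) w)
            ≡⟨ cong (degree S w ℕ.+ owned (h ∷ rest) w ℕ.+_) (asleep-next z w) ⟨
          degree S w ℕ.+ owned (h ∷ rest) w ℕ.+ asleep (h ∷ rest) w ∎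
          where open ℕ.≤-Reasoning

      first-visit : s ∉ spokes S → Invariant (graft z s τ′ S) (next s) τ′ D
      first-visit s∉ = record
        { unique    = Unique-resp-↭ (↭-sym spokes↭) (All.¬Any⇒All¬ (spokes S) s∉ ∷ unique)
        ; scheduled = Scheduled-graft z s τ′ center 0ℚ S scheduled z-early
        ; visited   = visited′
        ; θ≤D       = τ′≤D
        ; valid     = All.++⁺ (spawn-valid s s τ′ l s∈′ s∈′ s-departs ℚ.≤-refl l-finishes)
                     (All.++⁺ (spawn-valid s s τ′ t s∈′ s∈′ s-departs ℚ.≤-refl t-finishes)
                              (rest-valid grow old))
        ; capacity  = capacity′
        ; untouched = λ w w∉ →
            trans (asleep-next-elsewhere s (λ s≡w → w∉ (subst (_∈ spokes S′) s≡w s∈′)))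
                  (untouched w (w∉ ∘ grow))
        }
        where
        S′ : SpokeTree m
        S′ = graft z s τ′ S

        spokes↭ : spokes S′ ↭ s ∷ spokes S
        spokes↭ = spokes-graft z s τ′ S z∈

        grow : ∀ {w} → w ∈ spokes S → w ∈ spokes S′
        grow w∈ = ↭.∈-resp-↭ (↭-sym spokes↭) (there w∈)

        s∈′ : s ∈ spokes S′
        s∈′ = ↭.∈-resp-↭ (↭-sym spokes↭) (here refl)

        s≢ : ∀ {w} → w ∈ spokes S → s ≢ w
        s≢ w∈ s≡w = s∉ (subst (_∈ spokes S) (sym s≡w) w∈)

        visit-cases : ∀ {a β} → (a , β) ∈ visits S′ → (a , β) ≡ (s , τ′) ⊎ (a , β) ∈ visits S
        visit-cases v∈ with ↭.∈-resp-↭ (visits-graft z s τ′ S z∈) v∈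
        ... | here ≡new = inj₁ ≡new
        ... | there v∈S = inj₂ v∈S

        old : ∀ {o γ} → o ∈ spokes S → (o , γ) ∈ visits S′ → (o , γ) ∈ visits S
        old o∈ v∈ with visit-cases v∈
        ... | inj₁ refl = ⊥-elim (s∉ o∈)
        ... | inj₂ v∈S  = v∈S

        visited′ : ∀ {a β} → (a , β) ∈ visits S′ → β ≤ τ′
        visited′ v∈ with visit-cases v∈
        ... | inj₁ refl = ℚ.≤-refl
        ... | inj₂ v∈S  = ℚ.≤-trans (visited v∈S) θ≤τ′

        s-departs : ∀ {γ} → (s , γ) ∈ visits S′ → γ + ℓ s ≤ τ′ + ℓ s
        s-departs = ℚ.+-monoˡ-≤ (ℓ s) ∘ visited′

        z-early : ∀ {γ} → (z , γ) ∈ visits S → γ + dist ℓ (atLeaf z) (atLeaf s) ≤ τ′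
        z-early {γ} v∈
          rewrite dist-distinct (atLeaf z) s (s≢ z∈ ∘ sym ∘ leaf-injective)
                | dist-distinct (atLeaf y) s (s≢ (Valid.at∈ h-valid) ∘ sym ∘ leaf-injective) = begin
          γ + (ℓ z + ℓ s)  ≡⟨ ℚ.+-assoc γ (ℓ z) (ℓ s) ⟨
          γ + ℓ z + ℓ s    ≤⟨ ℚ.+-monoˡ-≤ (ℓ s) (Valid.departs h-valid v∈) ⟩
          τ + ℓ y + ℓ s    ≡⟨ ℚ.+-assoc τ (ℓ y) (ℓ s) ⟩
          τ + (ℓ y + ℓ s)  ∎
          where open ℚ.≤-Reasoning

        capacity′ : ∀ w → w ∈ spokes S′ →
                    degree S′ w ℕ.+ owned (next s) w ℕ.+ asleep (next s) w ℕ.≤ suc p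
        capacity′ w w∈ with ↭.∈-resp-↭ spokes↭ w∈
        ... | here refl = begin
          degree S′ s ℕ.+ owned (next s) s ℕ.+ asleep (next s) s
            ≡⟨ cong₂ (λ d a → d ℕ.+ owned (next s) s ℕ.+ a) degree-new asleep-new ⟩
          owned (next s) s ℕ.+ q
            ≤⟨ ℕ.+-monoˡ-≤ q (subst (owned (next s) s ℕ.≤_) two (owned-next s s)) ⟩
          2 ℕ.+ q ∎
          where
          open ℕ.≤-Reasoning
          degree-new : degree S′ s ≡ 0
          degree-new = trans (degree-graft z s τ′ S z∈ s)
                             (cong₂ ℕ._+_ (degree-absent S s s∉) (δ-distinct (s≢ z∈ ∘ sym)))
          asleep-new : asleep (next s) s ≡ q
          asleep-new = ℕ.suc-injective (trans (cong (ℕ._+ asleep (next s) s) (sym (δ-refl s)))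
                                              (trans (sym (asleep-next s s)) (untouched s s∉)))
          two : δ s s ℕ.+ (δ s s ℕ.+ owned rest s) ≡ 2
          two = cong₂ (λ i o → i ℕ.+ (i ℕ.+ o)) (δ-refl s) (owned-rest-absent s s∉)
        ... | there w∈S = begin
          degree S′ w ℕ.+ owned (next s) w ℕ.+ asleep (next s) w
            ≤⟨ ℕ.+-mono-≤ (ℕ.+-mono-≤ (ℕ.≤-reflexive (degree-graft z s τ′ S z∈ w)) (owned-next s w))
                          (ℕ.≤-reflexive (asleep-next-elsewhere s (s≢ w∈S))) ⟩
          degree S w ℕ.+ δ z w ℕ.+ (δ s w ℕ.+ (δ s w ℕ.+ owned rest w)) ℕ.+ asleep (h ∷ rest) w
            ≡⟨ cong (λ i → degree S w ℕ.+ δ z w ℕ.+ (i ℕ.+ (i ℕ.+ owned rest w)) ℕ.+ asleep (h ∷ rest) w)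
                    (δ-distinct (s≢ w∈S)) ⟩
          degree S w ℕ.+ δ z w ℕ.+ owned rest w ℕ.+ asleep (h ∷ rest) w
            ≡⟨ cong (ℕ._+ asleep (h ∷ rest) w) (ℕ.+-assoc (degree S w) (δ z w) (owned rest w)) ⟩
          degree S w ℕ.+ owned (h ∷ rest) w ℕ.+ asleep (h ∷ rest) w
            ≤⟨ capacity w w∈S ⟩
          suc p ∎
          where open ℕ.≤-Reasoning

    step : ∀ {S g W θ D} → Invariant S (g ∷ W) θ D →
           Σ (SpokeTree m) λ S′ → Σ (List Agent) λ W′ → Σ ℚ λ θ′ →
             Invariant S′ W′ θ′ D × suc (workload W′) ≡ workload (g ∷ W)
    step {S} {g} {W} inv with extractMin arrival g W
    ... | agent z y τ r l t , rest , ↭rest , earliest with spoke r ∈? spokes S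
    ...   | yes s∈ = S , next z , τ′ , revisit s∈ ,
                     trans (workload-next z) (sym (sumOf-↭ (length ∘ pending) ↭rest))
      where open Step (Invariant-resp-↭ ↭rest inv) earliest
    ...   | no s∉  = graft z s τ′ S , next s , τ′ , first-visit s∉ ,
                     trans (workload-next s) (sym (sumOf-↭ (length ∘ pending) ↭rest))
      where open Step (Invariant-resp-↭ ↭rest inv) earliest

    run : ∀ n {S W θ D} → workload W ≡ n → Invariant S W θ D →
          Σ (SpokeTree m) λ S′ → Σ ℚ λ θ′ → Invariant S′ [] θ′ D
    run n       {W = []}    _  inv = _ , _ , inv
    run zero    {W = _ ∷ _} () _
    run (suc n) {W = _ ∷ _} eq inv with _ , _ , _ , inv′ , eq′ ← step inv =
      run n (ℕ.suc-injective (trans eq′ eq)) inv′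

    -- The source reaches the first spoke s₀ at time ℓ s₀, where the two
    -- branches of the awakening tree start.
    module Start (r₀ : Robot m p) (L R : Tree) (valid : labels (node r₀ L R) ↭ allRobots m p) where

      s₀ : Fin m
      s₀ = spoke r₀

      S₀ : SpokeTree m
      S₀ = visit s₀ (ℓ s₀) []

      W₀ : List Agent
      W₀ = spawn s₀ s₀ (ℓ s₀) L ++ spawn s₀ s₀ (ℓ s₀) R

      D : ℚ
      D = makespan ℓ (node r₀ L R)

      asleep-start : ∀ z → δ s₀ z ℕ.+ asleep W₀ z ≡ p
      asleep-start z = begin
        δ s₀ z ℕ.+ asleep W₀ z
          ≡⟨ cong (δ s₀ z ℕ.+_) (sumOf-++ _ (spawn s₀ s₀ (ℓ s₀) L) _) ⟩
        δ s₀ z ℕ.+ (asleep (spawn s₀ s₀ (ℓ s₀) L) z ℕ.+ asleep (spawn s₀ s₀ (ℓ s₀) R) z)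
          ≡⟨ cong (δ s₀ z ℕ.+_)
                  (cong₂ ℕ._+_ (asleep-spawn s₀ s₀ (ℓ s₀) L z) (asleep-spawn s₀ s₀ (ℓ s₀) R z)) ⟩
        δ s₀ z ℕ.+ (count z (labels L) ℕ.+ count z (labels R))
          ≡⟨ cong (δ s₀ z ℕ.+_) (sumOf-++ _ (labels L) (labels R)) ⟨
        count z (labels (node r₀ L R))
          ≡⟨ sumOf-↭ _ valid ⟩
        count z (allRobots m p)
          ≡⟨ count-allRobots z ⟩
        p ∎
        where open ≡-Reasoning

      L-finishes : ℓ s₀ + finish ℓ (atLeaf s₀) L ≤ D
      L-finishes = ℚ.+-monoʳ-≤ (ℓ s₀) (ℚ.p≤p⊔q (finish ℓ (atLeaf s₀) L) (finish ℓ (atLeaf s₀) R))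

      R-finishes : ℓ s₀ + finish ℓ (atLeaf s₀) R ≤ D
      R-finishes = ℚ.+-monoʳ-≤ (ℓ s₀) (ℚ.p≤q⊔p (finish ℓ (atLeaf s₀) L) (finish ℓ (atLeaf s₀) R))

      departs : ∀ {γ} → (s₀ , γ) ∈ visits S₀ → γ + ℓ s₀ ≤ ℓ s₀ + ℓ s₀
      departs (here refl) = ℚ.≤-refl

      start : Invariant S₀ W₀ (ℓ s₀) D
      start = record
        { unique    = [] ∷ []
        ; scheduled = ℚ.≤-reflexive (ℚ.+-identityˡ (ℓ s₀)) , tt
        ; visited   = λ { (here refl) → ℚ.≤-refl }
        ; θ≤D       = ℚ.≤-trans (p≤p+q (finish-nonneg (atLeaf s₀) L)) L-finishes
        ; valid     = All.++⁺ (spawn-valid s₀ s₀ (ℓ s₀) L (here refl) (here refl) departs ℚ.≤-refl L-finishes)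
                              (spawn-valid s₀ s₀ (ℓ s₀) R (here refl) (here refl) departs ℚ.≤-refl R-finishes)
        ; capacity  = λ { z (here refl) → capacity₀ }
        ; untouched = λ z z∉ → trans (cong (ℕ._+ asleep W₀ z) (sym (δ-distinct (z∉ ∘ here ∘ sym))))
                                     (asleep-start z)
        }
        where
        capacity₀ : degree S₀ s₀ ℕ.+ owned W₀ s₀ ℕ.+ asleep W₀ s₀ ℕ.≤ suc p
        capacity₀ = begin
          degree S₀ s₀ ℕ.+ owned W₀ s₀ ℕ.+ asleep W₀ s₀
            ≡⟨ cong₂ (λ d a → d ℕ.+ owned W₀ s₀ ℕ.+ a) (degree-leaf s₀ (ℓ s₀) s₀) asleep₀ ⟩
          owned W₀ s₀ ℕ.+ q
            ≤⟨ ℕ.+-monoˡ-≤ q owned₀ ⟩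
          2 ℕ.+ q ∎
          where
          open ℕ.≤-Reasoning
          owned₀ : owned W₀ s₀ ℕ.≤ 2
          owned₀ = subst₂ ℕ._≤_ (sym (sumOf-++ _ (spawn s₀ s₀ (ℓ s₀) L) _))
                                (cong₂ ℕ._+_ (δ-refl s₀) (δ-refl s₀))
                                (ℕ.+-mono-≤ (owned-spawn s₀ s₀ (ℓ s₀) L s₀) (owned-spawn s₀ s₀ (ℓ s₀) R s₀))
          asleep₀ : asleep W₀ s₀ ≡ q
          asleep₀ = ℕ.suc-injective
            (trans (cong (ℕ._+ asleep W₀ s₀) (sym (δ-refl s₀))) (asleep-start s₀))

    lower-bound : ∀ r₀ L R → labels (node r₀ L R) ↭ allRobots m p →
                  Σ (SpokeTree m) λ S →
                    spokes S ↭ allFin m × MaxDegree (suc p) S × cost center S ≤ makespan ℓ (node r₀ L R)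
    lower-bound r₀ L R valid with S , _ , inv ← run _ refl (Start.start r₀ L R valid) =
      S , spokes↭ , MaxDegree-from-degree S degree≤ ,
      subst (_≤ _) (ℚ.+-identityˡ _)
            (Scheduled⇒cost≤ center 0ℚ S scheduled (λ v∈ → ℚ.≤-trans (visited v∈) θ≤D))
      where
      open Invariant inv

      visited-all : ∀ z → z ∈ spokes S
      visited-all z with z ∈? spokes S
      ... | yes z∈ = z∈
      ... | no z∉ with () ← untouched z z∉

      spokes↭ : spokes S ↭ allFin m
      spokes↭ = Unique∧⊆⊇⇒↭ unique (Uniqueₚ.allFin⁺ m) (λ _ → ∈-allFin _) (λ {z} _ → visited-all z)

      degree≤ : ∀ z → degree S z ℕ.≤ suc p
      degree≤ z = subst (ℕ._≤ suc p) (trans (ℕ.+-identityʳ _) (ℕ.+-identityʳ _))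
                        (capacity z (visited-all z))

-- Optimal awakening trees

module _ {m p : ℕ} (ℓ : Fin m → ℚ) where

  IsAwakeningTree? : ∀ T → Dec (IsAwakeningTree m p T)
  IsAwakeningTree? T = (≡-dec Fin._≟_ Fin._≟_ ↭? labels T) (allRobots m p)

  -- A minimum exists since every awakening tree is among the finitely
  -- many trees with at most |allRobots m p| nodes labelled by robots.
  optimal-exists : Σ (BTree (Robot m p)) (IsOptimal m p ℓ)
  optimal-exists = best , best-valid , best-optimal
    where
    smallTrees : List (BTree (Robot m p))
    smallTrees = treesOver (allRobots m p) (length (allRobots m p))

    candidates : List (BTree (Robot m p))
    candidates = filter IsAwakeningTree? smallTrees

    spine-valid : IsAwakeningTree m p (spine (allRobots m p))
    spine-valid = ↭-reflexive (labels-spine (allRobots m p))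

    best : BTree (Robot m p)
    best = Extrema.argmin (makespan ℓ) (spine (allRobots m p)) candidates

    best-valid : IsAwakeningTree m p best
    best-valid = Extrema.argmin-all (makespan ℓ) spine-valid (All.all-filter IsAwakeningTree? smallTrees)

    best-optimal : ∀ T → IsAwakeningTree m p T → makespan ℓ best ≤ makespan ℓ T
    best-optimal T valid = All.lookup (Extrema.f[argmin]≤f[xs] {f = makespan ℓ} _ candidates)
      (∈-filter⁺ IsAwakeningTree? T∈smallTrees valid)
      where
      T∈smallTrees : T ∈ smallTrees
      T∈smallTrees = ∈-treesOver (length (allRobots m p)) T (ℕ.≤-reflexive (↭.↭-length valid))
                                 (All.tabulate (↭.∈-resp-↭ valid))

module _ {m : ℕ} (ℓ : Fin m → ℚ) (ℓ≥0 : ∀ i → 0ℚ ≤ ℓ i) where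

  open Star ℓ ℓ≥0

  nondecreasing-no-slower :
    ∀ {p} T → IsAwakeningTree m p T →
    Σ (BTree (Robot m p)) λ T′ →
      (IsAwakeningTree m p T′ × NondecreasingPaths ℓ T′) × makespan ℓ T′ ≤ makespan ℓ T
  nondecreasing-no-slower         nil                 valid = nil , (valid , []) , ℚ.≤-refl
  nondecreasing-no-slower {zero}  (node (_ , ()) _ _) _
  nondecreasing-no-slower {suc q} (node r₀ L R)       valid
    with S , spokes↭ , deg , cost≤ ← Simulation.lower-bound q r₀ L R valid
    with S′ , spokes′↭ , deg′ , mono , cost′≤ ←
           monotonize (size S) S ℕ.≤-refl center (Unique-resp-↭ (↭-sym spokes↭) (Uniqueₚ.allFin⁺ m))
             (λ {i} _ → (λ ()) , ℓ≥0 i) deg =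
    realize S′ ,
    (↭-trans (labels-realize S′ deg′) (concatMap-↭ robotsAt (↭-trans spokes′↭ spokes↭)) ,
     HeapOrdered⇒paths-linked Descends (realize S′) (HeapOrdered-realize center S′ mono)) ,
    ℚ.≤-trans (finish-realize center S′) (ℚ.≤-trans cost′≤ cost≤)
    where open Realization q

lemma2p2 : (m p : ℕ) (ℓ : Fin m → ℚ) → (∀ i → 0ℚ < ℓ i) →
    Σ (BTree (Robot m p)) (λ T → IsOptimal m p ℓ T × NondecreasingPaths ℓ T)
lemma2p2 m p ℓ ℓ>0
  with T* , valid* , optimal* ← optimal-exists {m} {p} ℓ
  with T , (valid , nondecreasing) , T≤T* ← nondecreasing-no-slower ℓ (ℚ.<⇒≤ ∘ ℓ>0) T* valid* =
  T , (valid , λ T′ valid′ → ℚ.≤-trans T≤T* (optimal* T′ valid′)) , nondecreasing
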